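{- Let $G$ be a binary quasigroup of order $n$, let $U,V\in\mathcal I_n^n$, and let $\mathcal U_1,\dots,\mathcal U_m$ be the partition of $\mathcal I_n^n$ into equivalence classes, of periods $\tau_1,\dots,\tau_m$ respectively. Suppose that all units of the class $\mathcal U_i$ have size $r_i n^{n-1}$, where $1\le r_i\le n$. Then: \begin{itemize} \item If $U$ and $V$ belong to different equivalence classes, then for all $d$ there are no $U$-diagonals of type $V$ in $G[d]$. \item If $U$ and $V$ belong to the same equivalence class $\mathcal U_i$, then there is $k\in\{0,\dots,\tau_i-1\}$ and $d_0\in\mathbb N$ such that for all $d>d_0$ the number $T_{U,V}(d)$ of $U$-diagonals of type $V$ in $G[d]$ satisfies $$T_{U,V}(d)=\frac{n!^{d}}{r_i n^{n-1}}(1+o(1))\ \text{ if } d\equiv k \pmod{\tau_i},\qquad T_{U,V}(d)=0 \text{ otherwise}.$$ \end{itemize}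
   Context: Let $\mathcal I_n=\{1,\dots,n\}$. A binary quasigroup $G$ of order $n$ is the set $\mathcal I_n$ with an operation $*$ such that for all $a_0,a_1,a_2$ there are unique $x_1,x_2$ with $a_1*x_2=a_0$ and $x_1*a_2=a_0$. Elements of $\mathcal I_n^n$ are called tuples; $*$ is applied to tuples entrywise. A tuple with pairwise distinct entries is a permutation; $\mathcal W$ is the set of permutations. For $d\ge0$, $G[d]$ is the $d$-iterated quasigroup $G[d](x_1,\dots,x_{d+1})=(\cdots(x_1*x_2)*\cdots)*x_{d+1}$ (with $G[0]$ the identity map). A $U$-diagonal of type $V$ in $G[d]$ is a sequence $(W_1,\dots,W_d)\in\mathcal W^d$ with $(\cdots((U*W_1)*W_2)*\cdots)*W_d=V$ entrywise. Tuples $U,V$ are equivalent if for some $d\ge0$ there is a $U$-diagonal of type $V$ in $G[d]$; this is an equivalence relation whose classes are called equivalence classes. The period $\tau$ of a class $\mathcal U$ is the gcd of all $d\ge1$ for which some $U\in\mathcal U$ admits a $U$-diagonal of type $U$ in $G[d]$. A class of period $\tau$ is partitioned into $\tau$ sets $\mathcal Y_1,\dots,\mathcal Y_\tau$, called units, such that for $U\in\mathcal Y_k$, $V\in\mathcal Y_l$ a $U$-diagonal of type $V$ in $G[d]$ exists only if $l-k\equiv d\pmod\tau$ (these are the cyclic classes of the corresponding irreducible block of the matrix $(t_{U,V})$, $t_{U,V}=\#\{W\in\mathcal W: U*W=V\}$). -}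

module Defs where

open import Data.Nat using (ℕ; zero; suc; _+_; _*_; _∸_; _^_; _≤_; _<_; _!; ∣_-_∣)
open import Data.Nat.Divisibility using (_∣_)
open import Data.Fin using (Fin; toℕ)
open import Data.Fin.Properties using (all?) renaming (_≟_ to _≟ᶠ_)
open import Data.Vec using (Vec; []; _∷_; zipWith; lookup)
open import Data.Vec.Properties using (≡-dec)
open import Data.List using (List; []; _∷_; map; concatMap; length; filter; foldl; allFin)
open import Data.List.Relation.Unary.All using (All)
open import Data.List.Relation.Unary.Unique.Propositional using (Unique)
open import Data.List.Membership.Propositional using (_∈_)
open import Data.Product using (Σ; ∃; ∃!; _×_; _,_)
open import Relation.Nullary.Decidable using (Dec; _→-dec_)
open import Relation.Binary.PropositionalEquality using (_≡_)
open import Function.Bundles using (_⇔_)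
open import Data.Integer using (+_)
import Data.Rational as ℚ
open ℚ using (ℚ; 0ℚ; 1ℚ)

-- I_n is modelled as Fin n; a binary operation on I_n.
Op : ℕ → Set
Op n = Fin n → Fin n → Fin n

IsQuasigroup : {n : ℕ} → Op n → Set
IsQuasigroup {n} _∙_ =
  (∀ (a₁ a₀ : Fin n) → ∃! _≡_ (λ x₂ → a₁ ∙ x₂ ≡ a₀)) ×
  (∀ (a₂ a₀ : Fin n) → ∃! _≡_ (λ x₁ → x₁ ∙ a₂ ≡ a₀))

Tuple : ℕ → Set
Tuple n = Vec (Fin n) n

_⟨_⟩_ : {n : ℕ} → Tuple n → Op n → Tuple n → Tuple n
U ⟨ op ⟩ W = zipWith op U W

IsPerm : {n : ℕ} → Tuple n → Set
IsPerm {n} W = ∀ (i j : Fin n) → lookup W i ≡ lookup W j → i ≡ j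

isPerm? : {n : ℕ} (W : Tuple n) → Dec (IsPerm W)
isPerm? W = all? (λ i → all? (λ j → (lookup W i ≟ᶠ lookup W j) →-dec (i ≟ᶠ j)))

applySeq : {n : ℕ} → Op n → Tuple n → List (Tuple n) → Tuple n
applySeq op U Ws = foldl (λ acc W → acc ⟨ op ⟩ W) U Ws

Diagonal : {n : ℕ} → Op n → Tuple n → Tuple n → ℕ → Set
Diagonal {n} op U V d =
  Σ (List (Tuple n)) λ Ws → (length Ws ≡ d) × All IsPerm Ws × (applySeq op U Ws ≡ V)

Equiv : {n : ℕ} → Op n → Tuple n → Tuple n → Set
Equiv op U V = ∃ λ d → Diagonal op U V d

allVecs : {n : ℕ} (m : ℕ) → List (Vec (Fin n) m)
allVecs {n} zero = [] ∷ []
allVecs {n} (suc m) = concatMap (λ a → map (a ∷_) (allVecs m)) (allFin n)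

allPerms : (n : ℕ) → List (Tuple n)
allPerms n = filter isPerm? (allVecs n)

permSeqs : (n d : ℕ) → List (List (Tuple n))
permSeqs n zero = [] ∷ []
permSeqs n (suc d) = concatMap (λ W → map (W ∷_) (permSeqs n d)) (allPerms n)

T : {n : ℕ} → Op n → Tuple n → Tuple n → ℕ → ℕ
T {n} op U V d = length (filter (λ Ws → ≡-dec _≟ᶠ_ (applySeq op U Ws) V) (permSeqs n d))

CongMod : ℕ → ℕ → ℕ → Set
CongMod m a b = m ∣ ∣ a - b ∣

-- τ is the period of the class of U: the gcd of all d ≥ 1 such that some U'
-- in the class of U admits a U'-diagonal of type U' in G[d].
CycleLength : {n : ℕ} → Op n → Tuple n → ℕ → Set
CycleLength {n} op U d = (1 ≤ d) × ∃ λ (U' : Tuple n) → Equiv op U U' × Diagonal op U' U' d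

IsPeriod : {n : ℕ} → Op n → Tuple n → ℕ → Set
IsPeriod op U τ =
  (∀ d → CycleLength op U d → τ ∣ d) ×
  (∀ c → (∀ d → CycleLength op U d → c ∣ d) → c ∣ τ)

-- A partition of the class of X (of period τ) into units Y_0,...,Y_{τ-1},
-- given by a labelling y, with the defining property: for Z ∈ Y_k, Z' ∈ Y_l,
-- a Z-diagonal of type Z' in G[d] exists only if l - k ≡ d (mod τ).
IsUnitLabelling : {n : ℕ} → Op n → Tuple n → (τ : ℕ) → (Tuple n → Fin τ) → Set
IsUnitLabelling op X τ y =
  ∀ Z Z' d → Equiv op X Z → Equiv op X Z' → Diagonal op Z Z' d →
    CongMod τ (toℕ (y Z) + d) (toℕ (y Z'))

UnitHasSize : {n : ℕ} → Op n → Tuple n → (τ : ℕ) → (Tuple n → Fin τ) → Fin τ → ℕ → Set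
UnitHasSize {n} op X τ y j s =
  Σ (List (Tuple n)) λ L → Unique L ×
    (∀ Z → (Z ∈ L) ⇔ (Equiv op X Z × y Z ≡ j)) × (length L ≡ s)

AllUnitsHaveSize : {n : ℕ} → Op n → Tuple n → ℕ → ℕ → Set
AllUnitsHaveSize op X τ s =
  Σ _ λ y → IsUnitLabelling op X τ y × (∀ j → UnitHasSize op X τ y j s)

ℕtoℚ : ℕ → ℚ
ℕtoℚ m = + m ℚ./ 1

-- f(d) = num(d) / c · (1 + o(1)) as d → ∞ along d ≡ k (mod τ), written
-- without division: for every rational ε > 0 there is D such that for all
-- d > D with d ≡ k (mod τ):  |f(d) · c − num(d)| < ε · num(d).
AsymptoticAlong : (k τ : ℕ) → (f num : ℕ → ℕ) → (c : ℕ) → Set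
AsymptoticAlong k τ f num c =
  ∀ (ε : ℚ) → 0ℚ ℚ.< ε → ∃ λ D → ∀ d → D < d → CongMod τ d k →
    ℚ.∣ ℕtoℚ (f d * c) ℚ.- ℕtoℚ (num d) ∣ ℚ.< ε ℚ.* ℕtoℚ (num d)

-- T(d) is the (U,V) entry of the d-th power of the matrix t, whose rows and columns all sum to
-- n! (columns because right multiplication by a permutation is invertible in a quasigroup), and
-- an entry of a power is nonzero exactly when a diagonal exists.  Hence T vanishes across
-- classes, and the unit labelling forces d ≡ k (mod τ) inside a class.  The gcd g of finitely
-- many loop lengths at U divides every cycle length, hence τ, so all large multiples of τ are
-- loop lengths; this yields an m ≡ 0 (mod τ) for which every m-step entry inside the unit of U
-- is positive.  Restricted to that unit the m-step matrix has row sums (n!)^m, so every m steps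
-- shrink the spread of T(·, V, d) over the unit by the factor E / (E + s), E = (n!)^m − s, while
-- the column sum over the unit stays (n!)^d.  Hence T(d) · s = (n!)^d (1 + o(1)).

module Submission where

open import Defs
open import Data.Empty using (⊥-elim)
open import Data.Fin using (Fin; zero; suc; toℕ; combine)
import Data.Fin.Properties as Fin
open import Data.Fin.Properties using (pigeonhole; combine-injective; toℕ-injective; toℕ<n) renaming (_≟_ to _≟ᶠ_)
import Data.Integer as ℤ
import Data.Integer.Properties as ℤ
open import Data.List using (List; []; _∷_; map; concatMap; length; filter; allFin; _++_; cartesianProductWith; replicate)
open import Data.List.Properties using (length-tabulate; foldl-++; length-++; length-replicate)
open import Data.List.Membership.Propositional using (_∈_; _∉_; find)
open import Data.List.Membership.Propositional.Properties
  using (∈-allFin; ∈-cartesianProductWith⁺; ∈-filter⁺; ∈-filter⁻; ∈-concatMap⁺; ∈-concatMap⁻; ∈-map⁺; ∈-map⁻)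
open import Data.List.Relation.Unary.All as All using (All; []; _∷_)
open import Data.List.Relation.Unary.All.Properties using (All¬⇒¬Any; ¬Any⇒All¬; ++⁺)
import Data.List.Relation.Unary.Any as Any
open Any using (here; there; any?)
open import Data.List.Relation.Unary.AllPairs using ([]; _∷_)
open import Data.List.Relation.Unary.Unique.Propositional using (Unique)
open import Data.List.Relation.Unary.Unique.Propositional.Properties using (allFin⁺; cartesianProductWith⁺)
open import Data.Nat
  using (ℕ; zero; suc; _+_; _*_; _∸_; _^_; _≤_; _<_; _!; z≤n; s≤s; pred; NonZero; >-nonZero; ≢-nonZero; ∣_-_∣; _/_; _%_)
open import Data.Nat.Properties
open import Data.Nat.Divisibility
  using (_∣_; divides; ∣-trans; 0∣⇒≡0; quotient; m∣n⇒n≡quotient*m; ∣m+n∣m⇒∣n; ∣m∣n⇒∣m+n; n∣m*n; ∣n⇒∣m*n; m∣m*n)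
open import Data.Nat.DivMod using ([m+kn]%n≡m%n; m≡m%n+[m/n]*n; m%n<n; m%n%n≡m%n; m<n⇒m%n≡m; m*n/n≡m; /-monoˡ-≤)
open import Data.Nat.GCD using (gcd; gcd[m,n]∣m; gcd[m,n]∣n; gcd-GCD; module Bézout)
import Data.Nat.Coprimality as Coprimality
open import Data.Nat.Tactic.RingSolver using (solve-∀)
open import Data.Product using (∃; ∃₂; _×_; _,_; proj₁; proj₂)
import Data.Rational as ℚ
open ℚ using (ℚ; mkℚ; 0ℚ; toℚᵘ)
import Data.Rational.Properties as ℚ
import Data.Rational.Unnormalised as ℚᵘ
open ℚᵘ using (mkℚᵘ; _≃_; *≡*; *<*)
import Data.Rational.Unnormalised.Properties as ℚᵘ
open import Data.Sum using (inj₁; inj₂)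
open import Data.Vec using (Vec; []; _∷_; lookup; zipWith)
open import Data.Vec.Properties using (≡-dec; ∷-injective)
open import Function using (_∘_; id)
open import Function.Bundles using (Equivalence)
open import Relation.Binary.Definitions using (DecidableEquality)
open import Relation.Binary.PropositionalEquality
open import Relation.Nullary using (¬_; Dec; yes; no; ¬?; contradiction)
open import Algebra.Properties.CommutativeSemigroup +-commutativeSemigroup using (interchange; x∙yz≈y∙xz)

-- Finite sums

∑ : {A : Set} → List A → (A → ℕ) → ℕ
∑ []       f = 0
∑ (x ∷ xs) f = f x + ∑ xs f

∑-++ : {A : Set} (xs ys : List A) (f : A → ℕ) → ∑ (xs ++ ys) f ≡ ∑ xs f + ∑ ys f
∑-++ []       ys f = refl
∑-++ (x ∷ xs) ys f = trans (cong (f x +_) (∑-++ xs ys f)) (sym (+-assoc (f x) _ _))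

∑-map : {A B : Set} (g : A → B) (xs : List A) (f : B → ℕ) → ∑ (map g xs) f ≡ ∑ xs (f ∘ g)
∑-map g []       f = refl
∑-map g (x ∷ xs) f = cong (f (g x) +_) (∑-map g xs f)

∑-concatMap : {A B : Set} (g : A → List B) (xs : List A) (f : B → ℕ) →
              ∑ (concatMap g xs) f ≡ ∑ xs (λ x → ∑ (g x) f)
∑-concatMap g []       f = refl
∑-concatMap g (x ∷ xs) f =
  trans (∑-++ (g x) (concatMap g xs) f) (cong (∑ (g x) f +_) (∑-concatMap g xs f))

∑-cong-∈ : {A : Set} (xs : List A) {f g : A → ℕ} → (∀ x → x ∈ xs → f x ≡ g x) → ∑ xs f ≡ ∑ xs g
∑-cong-∈ []       e = refl
∑-cong-∈ (x ∷ xs) e = cong₂ _+_ (e x (here refl)) (∑-cong-∈ xs (λ y y∈xs → e y (there y∈xs)))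

∑-cong : {A : Set} (xs : List A) {f g : A → ℕ} → (∀ x → f x ≡ g x) → ∑ xs f ≡ ∑ xs g
∑-cong xs e = ∑-cong-∈ xs (λ x _ → e x)

∑-mono-≤ : {A : Set} (xs : List A) {f g : A → ℕ} → (∀ x → x ∈ xs → f x ≤ g x) → ∑ xs f ≤ ∑ xs g
∑-mono-≤ []       e = z≤n
∑-mono-≤ (x ∷ xs) e = +-mono-≤ (e x (here refl)) (∑-mono-≤ xs (λ y y∈xs → e y (there y∈xs)))

∑-+ : {A : Set} (xs : List A) (f g : A → ℕ) → ∑ xs (λ x → f x + g x) ≡ ∑ xs f + ∑ xs g
∑-+ []       f g = refl
∑-+ (x ∷ xs) f g = trans (cong (f x + g x +_) (∑-+ xs f g)) (interchange (f x) (g x) (∑ xs f) (∑ xs g))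

∑-*ˡ : {A : Set} (xs : List A) (c : ℕ) (f : A → ℕ) → ∑ xs (λ x → c * f x) ≡ c * ∑ xs f
∑-*ˡ []       c f = sym (*-zeroʳ c)
∑-*ˡ (x ∷ xs) c f = trans (cong (c * f x +_) (∑-*ˡ xs c f)) (sym (*-distribˡ-+ c (f x) (∑ xs f)))

∑-*ʳ : {A : Set} (xs : List A) (c : ℕ) (f : A → ℕ) → ∑ xs (λ x → f x * c) ≡ ∑ xs f * c
∑-*ʳ xs c f = trans (∑-cong xs (λ x → *-comm (f x) c)) (trans (∑-*ˡ xs c f) (*-comm c _))

∑-const : {A : Set} (xs : List A) (c : ℕ) → ∑ xs (λ _ → c) ≡ length xs * c
∑-const []       c = refl
∑-const (x ∷ xs) c = cong (c +_) (∑-const xs c)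

∑-comm : {A B : Set} (xs : List A) (ys : List B) (f : A → B → ℕ) →
         ∑ xs (λ x → ∑ ys (f x)) ≡ ∑ ys (λ y → ∑ xs (λ x → f x y))
∑-comm []       ys f = sym (trans (∑-const ys 0) (*-zeroʳ (length ys)))
∑-comm (x ∷ xs) ys f =
  trans (cong (∑ ys (f x) +_) (∑-comm xs ys f)) (sym (∑-+ ys (f x) (λ y → ∑ xs (λ x′ → f x′ y))))

∈⇒≤∑ : {A : Set} (xs : List A) (f : A → ℕ) {x : A} → x ∈ xs → f x ≤ ∑ xs f
∈⇒≤∑ (y ∷ xs) f (here refl)  = m≤m+n (f y) _
∈⇒≤∑ (y ∷ xs) f (there x∈xs) = ≤-trans (∈⇒≤∑ xs f x∈xs) (m≤n+m _ (f y))

∑-positive : {A : Set} (xs : List A) (f : A → ℕ) → 0 < ∑ xs f → ∃ λ x → x ∈ xs × 0 < f x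
∑-positive (y ∷ xs) f ∑>0 with f y in fy≡
... | suc _ = y , here refl , subst (0 <_) (sym fy≡) (s≤s z≤n)
... | zero with ∑-positive xs f ∑>0
...   | x , x∈xs , fx>0 = x , there x∈xs , fx>0

𝟙 : {P : Set} → Dec P → ℕ
𝟙 (yes _) = 1
𝟙 (no _)  = 0

𝟙-yes : {P : Set} (P? : Dec P) → P → 𝟙 P? ≡ 1
𝟙-yes (yes _) _  = refl
𝟙-yes (no ¬p) p = ⊥-elim (¬p p)

𝟙-no : {P : Set} (P? : Dec P) → ¬ P → 𝟙 P? ≡ 0
𝟙-no (yes p) ¬p = ⊥-elim (¬p p)
𝟙-no (no _)  _  = refl

𝟙-positive : {P : Set} (P? : Dec P) → 0 < 𝟙 P? → P
𝟙-positive (yes p) _ = p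

𝟙+𝟙¬≡1 : {P : Set} (P? : Dec P) → 𝟙 P? + 𝟙 (¬? P?) ≡ 1
𝟙+𝟙¬≡1 (yes _) = refl
𝟙+𝟙¬≡1 (no _)  = refl

length-filter≡∑𝟙 : {A : Set} {P : A → Set} (P? : ∀ x → Dec (P x)) (xs : List A) →
                    length (filter P? xs) ≡ ∑ xs (λ x → 𝟙 (P? x))
length-filter≡∑𝟙 P? []       = refl
length-filter≡∑𝟙 P? (x ∷ xs) with P? x
... | yes _ = cong suc (length-filter≡∑𝟙 P? xs)
... | no _  = length-filter≡∑𝟙 P? xs

module PointMass {A : Set} (_≟_ : DecidableEquality A) where

  δ : A → A → ℕ
  δ x y = 𝟙 (x ≟ y)

  δ-refl : ∀ x → δ x x ≡ 1
  δ-refl x = 𝟙-yes (x ≟ x) refl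

  δ-≢ : ∀ {x y} → x ≢ y → δ x y ≡ 0
  δ-≢ {x} {y} = 𝟙-no (x ≟ y)

  δ-sym : ∀ x y → δ x y ≡ δ y x
  δ-sym x y with x ≟ y
  ... | yes refl = sym (δ-refl x)
  ... | no x≢y   = sym (δ-≢ (x≢y ∘ sym))

  ∑-δ-∉ : ∀ {y} xs (f : A → ℕ) → y ∉ xs → ∑ xs (λ x → δ x y * f x) ≡ 0
  ∑-δ-∉ []       f y∉xs = refl
  ∑-δ-∉ (x ∷ xs) f y∉xs =
    cong₂ _+_ (cong (_* f x) (δ-≢ (λ x≡y → y∉xs (here (sym x≡y))))) (∑-δ-∉ xs f (y∉xs ∘ there))

  ∑-δ : ∀ {xs y} (f : A → ℕ) → Unique xs → y ∈ xs → ∑ xs (λ x → δ x y * f x) ≡ f y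
  ∑-δ {x ∷ xs} f (x∉xs ∷ _) (here refl) =
    trans (cong₂ _+_ (trans (cong (_* f x) (δ-refl x)) (*-identityˡ (f x))) (∑-δ-∉ xs f (All¬⇒¬Any x∉xs)))
          (+-identityʳ (f x))
  ∑-δ {x ∷ xs} f (x∉xs ∷ xs!) (there y∈xs) =
    cong₂ _+_ (cong (_* f x) (δ-≢ (λ { refl → All¬⇒¬Any x∉xs y∈xs }))) (∑-δ f xs! y∈xs)

  ∑-restrict : ∀ {xs ys} (f : A → ℕ) → Unique xs → Unique ys → (∀ {y} → y ∈ ys → y ∈ xs) →
               (∀ x → x ∉ ys → f x ≡ 0) → ∑ xs f ≡ ∑ ys f
  ∑-restrict {xs} {ys} f xs! ys! ys⊆xs f-vanishes = begin
    ∑ xs f                                  ≡⟨ ∑-cong xs (sym ∘ ∑-δ-ys) ⟩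
    ∑ xs (λ x → ∑ ys (λ y → δ y x * f y))   ≡⟨ ∑-comm xs ys _ ⟩
    ∑ ys (λ y → ∑ xs (λ x → δ y x * f y))   ≡⟨ ∑-cong-∈ ys ∑-δ-xs ⟩
    ∑ ys f                                  ∎
    where
    open ≡-Reasoning
    ∑-δ-ys : ∀ x → ∑ ys (λ y → δ y x * f y) ≡ f x
    ∑-δ-ys x with any? (x ≟_) ys
    ... | yes x∈ys = ∑-δ f ys! x∈ys
    ... | no x∉ys  = trans (∑-δ-∉ ys f x∉ys) (sym (f-vanishes x x∉ys))
    ∑-δ-xs : ∀ y → y ∈ ys → ∑ xs (λ x → δ y x * f y) ≡ f y
    ∑-δ-xs y y∈ys = trans (∑-cong xs (λ x → cong (_* f y) (δ-sym y x))) (∑-δ (λ _ → f y) xs! (ys⊆xs y∈ys))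

concatMap-map≡cartesianProductWith : {A B C : Set} (f : A → B → C) (xs : List A) (ys : List B) →
  concatMap (λ x → map (f x) ys) xs ≡ cartesianProductWith f xs ys
concatMap-map≡cartesianProductWith f []       ys = refl
concatMap-map≡cartesianProductWith f (x ∷ xs) ys =
  cong (map (f x) ys ++_) (concatMap-map≡cartesianProductWith f xs ys)

module _ {n : ℕ} where

  _≟ᵛ_ : ∀ {m} → DecidableEquality (Vec (Fin n) m)
  _≟ᵛ_ = ≡-dec _≟ᶠ_

  allVecs-suc : ∀ m → allVecs (suc m) ≡ cartesianProductWith _∷_ (allFin n) (allVecs m)
  allVecs-suc m = concatMap-map≡cartesianProductWith _∷_ (allFin n) (allVecs m)

  ∈-allVecs : ∀ {m} (v : Vec (Fin n) m) → v ∈ allVecs m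
  ∈-allVecs []      = here refl
  ∈-allVecs (a ∷ v) =
    subst (a ∷ v ∈_) (sym (allVecs-suc _)) (∈-cartesianProductWith⁺ _∷_ (∈-allFin a) (∈-allVecs v))

  allVecs⁺ : ∀ m → Unique (allVecs {n} m)
  allVecs⁺ zero    = [] ∷ []
  allVecs⁺ (suc m) =
    subst Unique (sym (allVecs-suc m)) (cartesianProductWith⁺ _∷_ ∷-injective (allFin⁺ n) (allVecs⁺ m))

-- Counting permutations

falling : ℕ → ℕ → ℕ
falling x zero    = 1
falling x (suc m) = x * falling (pred x) m

falling-n-n≡n! : ∀ n → falling n n ≡ n !
falling-n-n≡n! zero    = refl
falling-n-n≡n! (suc n) = cong (suc n *_) (falling-n-n≡n! n)

module _ {N : ℕ} where

  open import Data.List.Membership.DecPropositional (_≟ᶠ_ {N}) using (_∈?_)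
  open PointMass (_≟ᶠ_ {N}) using (∑-restrict)

  AllDistinct : ∀ {m} → Vec (Fin N) m → Set
  AllDistinct v = ∀ i j → lookup v i ≡ lookup v j → i ≡ j

  Avoids : ∀ {m} → List (Fin N) → Vec (Fin N) m → Set
  Avoids F v = ∀ i → lookup v i ∉ F

  -- The indicator of AllDistinct v and Avoids F v, as a product that can be summed entry by entry.
  fresh : ∀ {m} → List (Fin N) → Vec (Fin N) m → ℕ
  fresh F []      = 1
  fresh F (a ∷ v) = 𝟙 (¬? (a ∈? F)) * fresh (a ∷ F) v

  fresh≤1 : ∀ {m} F (v : Vec (Fin N) m) → fresh F v ≤ 1
  fresh≤1 F []      = ≤-refl
  fresh≤1 F (a ∷ v) with a ∈? F
  ... | yes _ = z≤n
  ... | no _  = ≤-trans (≤-reflexive (+-identityʳ _)) (fresh≤1 (a ∷ F) v)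

  fresh≡1⇒ : ∀ {m} F (v : Vec (Fin N) m) → fresh F v ≡ 1 → Avoids F v × AllDistinct v
  fresh≡1⇒ F []      _ = (λ ()) , (λ ())
  fresh≡1⇒ F (a ∷ v) fresh≡1 with a ∈? F
  ... | no a∉F with fresh≡1⇒ (a ∷ F) v (trans (sym (+-identityʳ _)) fresh≡1)
  ...   | avoids , distinct = avoids′ , distinct′
    where
    avoids′ : Avoids F (a ∷ v)
    avoids′ zero    = a∉F
    avoids′ (suc i) = avoids i ∘ there
    distinct′ : AllDistinct (a ∷ v)
    distinct′ zero    zero    _  = refl
    distinct′ zero    (suc j) eq = ⊥-elim (avoids j (here (sym eq)))
    distinct′ (suc i) zero    eq = ⊥-elim (avoids i (here eq))
    distinct′ (suc i) (suc j) eq = cong suc (distinct i j eq)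

  ⇒fresh≡1 : ∀ {m} F (v : Vec (Fin N) m) → Avoids F v → AllDistinct v → fresh F v ≡ 1
  ⇒fresh≡1 F []      _      _        = refl
  ⇒fresh≡1 F (a ∷ v) avoids distinct with a ∈? F
  ... | yes a∈F = ⊥-elim (avoids zero a∈F)
  ... | no _    = trans (+-identityʳ _) (⇒fresh≡1 (a ∷ F) v avoids′ distinct′)
    where
    avoids′ : Avoids (a ∷ F) v
    avoids′ i (here eq)  = Fin.0≢1+n (distinct zero (suc i) (sym eq))
    avoids′ i (there p) = avoids (suc i) p
    distinct′ : AllDistinct v
    distinct′ i j eq = Fin.suc-injective (distinct (suc i) (suc j) eq)

  ∑-∉ : ∀ F → Unique F → ∑ (allFin N) (λ a → 𝟙 (¬? (a ∈? F))) ≡ N ∸ length F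
  ∑-∉ F F! = begin
    ∑ (allFin N) 𝟙∉                              ≡⟨ m+n∸m≡n (∑ (allFin N) 𝟙∈) _ ⟨
    ∑ (allFin N) 𝟙∈ + ∑ (allFin N) 𝟙∉ ∸ ∑ (allFin N) 𝟙∈
      ≡⟨ cong₂ _∸_ (trans (sym (∑-+ (allFin N) 𝟙∈ 𝟙∉)) ∑-all) ∑-∈ ⟩
    N ∸ length F                                ∎
    where
    open ≡-Reasoning
    𝟙∈ 𝟙∉ : Fin N → ℕ
    𝟙∈ a = 𝟙 (a ∈? F)
    𝟙∉ a = 𝟙 (¬? (a ∈? F))
    ∑-all : ∑ (allFin N) (λ a → 𝟙∈ a + 𝟙∉ a) ≡ N
    ∑-all = trans (∑-cong (allFin N) (λ a → 𝟙+𝟙¬≡1 (a ∈? F)))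
                  (trans (∑-const (allFin N) 1) (trans (*-identityʳ _) (length-tabulate id)))
    ∑-∈ : ∑ (allFin N) 𝟙∈ ≡ length F
    ∑-∈ = begin
      ∑ (allFin N) 𝟙∈   ≡⟨ ∑-restrict 𝟙∈ (allFin⁺ N) F! (λ {a} _ → ∈-allFin a) (λ a a∉F → 𝟙-no (a ∈? F) a∉F) ⟩
      ∑ F 𝟙∈            ≡⟨ ∑-cong-∈ F (λ a a∈F → 𝟙-yes (a ∈? F) a∈F) ⟩
      ∑ F (λ _ → 1)     ≡⟨ trans (∑-const F 1) (*-identityʳ _) ⟩
      length F          ∎

  ∑-fresh : ∀ m F → Unique F → ∑ (allVecs m) (fresh F) ≡ falling (N ∸ length F) m
  ∑-fresh zero    F F! = refl
  ∑-fresh (suc m) F F! = begin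
    ∑ (allVecs (suc m)) (fresh F)
      ≡⟨ ∑-concatMap _ (allFin N) _ ⟩
    ∑ (allFin N) (λ a → ∑ (map (a ∷_) (allVecs m)) (fresh F))
      ≡⟨ ∑-cong (allFin N) (λ a → trans (∑-map (a ∷_) (allVecs m) (fresh F)) (∑-*ˡ (allVecs m) (𝟙∉ a) (fresh (a ∷ F)))) ⟩
    ∑ (allFin N) (λ a → 𝟙∉ a * ∑ (allVecs m) (fresh (a ∷ F)))
      ≡⟨ ∑-cong (allFin N) extend ⟩
    ∑ (allFin N) (λ a → 𝟙∉ a * falling (pred (N ∸ length F)) m)
      ≡⟨ ∑-*ʳ (allFin N) (falling (pred (N ∸ length F)) m) 𝟙∉ ⟩
    ∑ (allFin N) 𝟙∉ * falling (pred (N ∸ length F)) m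
      ≡⟨ cong (_* falling (pred (N ∸ length F)) m) (∑-∉ F F!) ⟩
    falling (N ∸ length F) (suc m) ∎
    where
    open ≡-Reasoning
    𝟙∉ : Fin N → ℕ
    𝟙∉ a = 𝟙 (¬? (a ∈? F))
    extend : ∀ a → 𝟙∉ a * ∑ (allVecs m) (fresh (a ∷ F)) ≡ 𝟙∉ a * falling (pred (N ∸ length F)) m
    extend a with a ∈? F
    ... | yes _  = refl
    ... | no a∉F = cong (1 *_) (trans (∑-fresh m (a ∷ F) (¬Any⇒All¬ F a∉F ∷ F!))
                                      (cong (λ x → falling x m) (sym (pred[m∸n]≡m∸[1+n] N (length F)))))

𝟙-isPerm≡fresh : ∀ {n} (W : Tuple n) → 𝟙 (isPerm? W) ≡ fresh [] W
𝟙-isPerm≡fresh W with isPerm? W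
... | yes W-perm = sym (⇒fresh≡1 [] W (λ _ ()) W-perm)
... | no ¬W-perm with m≤n⇒m<n∨m≡n (fresh≤1 [] W)
...   | inj₁ fresh<1 = sym (n<1⇒n≡0 fresh<1)
...   | inj₂ fresh≡1 = ⊥-elim (¬W-perm (proj₂ (fresh≡1⇒ [] W fresh≡1)))

length-allPerms : ∀ n → length (allPerms n) ≡ n !
length-allPerms n = begin
  length (allPerms n)               ≡⟨ length-filter≡∑𝟙 isPerm? (allVecs n) ⟩
  ∑ (allVecs n) (𝟙 ∘ isPerm?)       ≡⟨ ∑-cong (allVecs n) 𝟙-isPerm≡fresh ⟩
  ∑ (allVecs n) (fresh [])          ≡⟨ ∑-fresh n [] [] ⟩
  falling n n                       ≡⟨ falling-n-n≡n! n ⟩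
  n !                               ∎
  where open ≡-Reasoning

-- Congruences and additive submonoids of ℕ

-- Subtraction-free, and meaningful for g = 0: it is used before the modulus is known to be positive.
infix 4 _≡_mod_

_≡_mod_ : ℕ → ℕ → ℕ → Set
x ≡ y mod g = ∃₂ λ k l → x + k * g ≡ y + l * g

module _ {g : ℕ} where

  ≡⇒≡-mod : ∀ {x y} → x ≡ y → x ≡ y mod g
  ≡⇒≡-mod refl = 0 , 0 , refl

  ≡-mod-sym : ∀ {x y} → x ≡ y mod g → y ≡ x mod g
  ≡-mod-sym (k , l , eq) = l , k , sym eq

  ≡-mod-trans : ∀ {x y z} → x ≡ y mod g → y ≡ z mod g → x ≡ z mod g
  ≡-mod-trans {x} {y} {z} (k , l , eq) (k′ , l′ , eq′) = k + k′ , l′ + l , (begin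
    x + (k + k′) * g      ≡⟨ shuffle x k k′ g ⟩
    (x + k * g) + k′ * g  ≡⟨ cong (_+ k′ * g) eq ⟩
    (y + l * g) + k′ * g  ≡⟨ swap y l k′ g ⟩
    (y + k′ * g) + l * g  ≡⟨ cong (_+ l * g) eq′ ⟩
    (z + l′ * g) + l * g  ≡⟨ shuffle z l′ l g ⟨
    z + (l′ + l) * g      ∎)
    where
    open ≡-Reasoning
    shuffle : ∀ x k k′ g → x + (k + k′) * g ≡ (x + k * g) + k′ * g
    shuffle = solve-∀
    swap : ∀ y l k′ g → (y + l * g) + k′ * g ≡ (y + k′ * g) + l * g
    swap = solve-∀

  +-cong-mod : ∀ {x y x′ y′} → x ≡ y mod g → x′ ≡ y′ mod g → x + x′ ≡ y + y′ mod g
  +-cong-mod {x} {y} {x′} {y′} (k , l , eq) (k′ , l′ , eq′) = k + k′ , l + l′ , (begin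
    x + x′ + (k + k′) * g        ≡⟨ shuffle x x′ k k′ g ⟩
    (x + k * g) + (x′ + k′ * g)  ≡⟨ cong₂ _+_ eq eq′ ⟩
    (y + l * g) + (y′ + l′ * g)  ≡⟨ shuffle y y′ l l′ g ⟨
    y + y′ + (l + l′) * g        ∎)
    where
    open ≡-Reasoning
    shuffle : ∀ x x′ k k′ g → x + x′ + (k + k′) * g ≡ (x + k * g) + (x′ + k′ * g)
    shuffle = solve-∀

  +-cancelʳ-mod : ∀ {x y} z → x + z ≡ y + z mod g → x ≡ y mod g
  +-cancelʳ-mod {x} {y} z (k , l , eq) =
    k , l , +-cancelʳ-≡ z _ _ (trans (shuffle x k g z) (trans eq (sym (shuffle y l g z))))
    where
    shuffle : ∀ x k g z → x + k * g + z ≡ x + z + k * g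
    shuffle = solve-∀

  +-cancelˡ-mod : ∀ z {x y} → z + x ≡ z + y mod g → x ≡ y mod g
  +-cancelˡ-mod z {x} {y} zx≡zy = +-cancelʳ-mod z (subst₂ (_≡_mod g) (+-comm z x) (+-comm z y) zx≡zy)

  ∣⇒≡0-mod : ∀ {x} → g ∣ x → x ≡ 0 mod g
  ∣⇒≡0-mod (divides q refl) = 0 , q , +-identityʳ _

  ≡0-mod⇒∣ : ∀ {x} → x ≡ 0 mod g → g ∣ x
  ≡0-mod⇒∣ {x} (k , l , eq) =
    ∣m+n∣m⇒∣n (subst (g ∣_) (trans (sym eq) (+-comm x (k * g))) (n∣m*n l)) (n∣m*n k)

  ≡-mod⇒%≡ : ∀ {x y} .{{_ : NonZero g}} → x ≡ y mod g → x % g ≡ y % g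
  ≡-mod⇒%≡ {x} {y} (k , l , eq) =
    trans (sym ([m+kn]%n≡m%n x k g)) (trans (cong (_% g) eq) ([m+kn]%n≡m%n y l g))

  %≡⇒≡-mod : ∀ {x y} .{{_ : NonZero g}} → x % g ≡ y % g → x ≡ y mod g
  %≡⇒≡-mod {x} {y} eq = ≡-mod-trans (≡-mod-sym (div x)) (≡-mod-trans (≡⇒≡-mod eq) (div y))
    where
    div : ∀ z → z % g ≡ z mod g
    div z = z / g , 0 , trans (sym (m≡m%n+[m/n]*n z g)) (sym (+-identityʳ z))

  ∸⇒≡-mod : ∀ {x y} → x ≤ y → g ∣ y ∸ x → x ≡ y mod g
  ∸⇒≡-mod {x} {y} x≤y (divides q y∸x≡) =
    q , 0 , trans (cong (x +_) (sym y∸x≡)) (trans (m+[n∸m]≡n x≤y) (sym (+-identityʳ y)))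

  ≡-mod⇒∸ : ∀ {x y} → x ≤ y → x ≡ y mod g → g ∣ y ∸ x
  ≡-mod⇒∸ {x} {y} x≤y x≡y = ≡0-mod⇒∣ (≡-mod-sym (+-cancelˡ-mod x
    (≡-mod-trans (≡⇒≡-mod (+-identityʳ x)) (≡-mod-trans x≡y (≡⇒≡-mod (sym (m+[n∸m]≡n x≤y)))))))

  CongMod⇒≡-mod : ∀ {x y} → CongMod g x y → x ≡ y mod g
  CongMod⇒≡-mod {x} {y} g∣∣x-y∣ with ≤-total x y
  ... | inj₁ x≤y = ∸⇒≡-mod x≤y (subst (g ∣_) (m≤n⇒∣m-n∣≡n∸m x≤y) g∣∣x-y∣)
  ... | inj₂ y≤x = ≡-mod-sym (∸⇒≡-mod y≤x (subst (g ∣_) (trans (∣-∣-comm x y) (m≤n⇒∣m-n∣≡n∸m y≤x)) g∣∣x-y∣))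

  ≡-mod⇒CongMod : ∀ {x y} → x ≡ y mod g → CongMod g x y
  ≡-mod⇒CongMod {x} {y} x≡y with ≤-total x y
  ... | inj₁ x≤y = subst (g ∣_) (sym (m≤n⇒∣m-n∣≡n∸m x≤y)) (≡-mod⇒∸ x≤y x≡y)
  ... | inj₂ y≤x = subst (g ∣_) (sym (trans (∣-∣-comm x y) (m≤n⇒∣m-n∣≡n∸m y≤x))) (≡-mod⇒∸ y≤x (≡-mod-sym x≡y))

gcdList : List ℕ → ℕ
gcdList []       = 0
gcdList (c ∷ cs) = gcd c (gcdList cs)

gcdList-∣ : ∀ cs → All (gcdList cs ∣_) cs
gcdList-∣ []       = []
gcdList-∣ (c ∷ cs) = gcd[m,n]∣m c (gcdList cs) ∷ All.map (∣-trans (gcd[m,n]∣n c (gcdList cs))) (gcdList-∣ cs)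

module AdditiveSubmonoid (C : ℕ → Set) (C-0 : C 0) (C-+ : ∀ {a b} → C a → C b → C (a + b)) where

  C-* : ∀ k {x} → C x → C (k * x)
  C-* zero    _  = C-0
  C-* (suc k) Cx = C-+ Cx (C-* k Cx)

  -- Bézout's identity, carried out inside C.
  gcd-gap : ∀ cs → All C cs → ∃₂ λ P Q → C P × C Q × P ≡ Q + gcdList cs × gcdList cs ∣ Q
  gcd-gap []       []         = 0 , 0 , C-0 , C-0 , refl , divides 0 refl
  gcd-gap (c ∷ cs) (Cc ∷ Ccs) with gcd-gap cs Ccs | Bézout.identity (gcd-GCD c (gcdList cs))
  ... | P′ , Q′ , CP′ , CQ′ , P′≡ , g′∣Q′ | Bézout.+- x y g+yg′≡xc =
    x * c + y * Q′ , y * P′ , C-+ (C-* x Cc) (C-* y CQ′) , C-* y CP′ ,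
    (begin
      x * c + y * Q′       ≡⟨ cong (_+ y * Q′) g+yg′≡xc ⟨
      g + y * g′ + y * Q′  ≡⟨ shuffle g y g′ Q′ ⟩
      y * (Q′ + g′) + g    ≡⟨ cong (λ z → y * z + g) P′≡ ⟨
      y * P′ + g           ∎) ,
    ∣n⇒∣m*n y (subst (g ∣_) (sym P′≡) (∣m∣n⇒∣m+n (∣-trans g∣g′ g′∣Q′) g∣g′))
    where
    open ≡-Reasoning
    g g′ : ℕ
    g = gcd c (gcdList cs)
    g′ = gcdList cs
    g∣g′ : g ∣ g′
    g∣g′ = gcd[m,n]∣n c g′
    shuffle : ∀ g y g′ Q′ → g + y * g′ + y * Q′ ≡ y * (Q′ + g′) + g
    shuffle = solve-∀
  ... | P′ , Q′ , CP′ , CQ′ , P′≡ , g′∣Q′ | Bézout.-+ x y g+xc≡yg′ =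
    y * P′ , x * c + y * Q′ , C-* y CP′ , C-+ (C-* x Cc) (C-* y CQ′) ,
    (begin
      y * P′               ≡⟨ cong (y *_) P′≡ ⟩
      y * (Q′ + g′)        ≡⟨ shuffle₁ y Q′ g′ ⟩
      y * g′ + y * Q′      ≡⟨ cong (_+ y * Q′) g+xc≡yg′ ⟨
      g + x * c + y * Q′   ≡⟨ shuffle₂ g (x * c) (y * Q′) ⟩
      x * c + y * Q′ + g   ∎) ,
    ∣m∣n⇒∣m+n (∣n⇒∣m*n x (gcd[m,n]∣m c g′)) (∣n⇒∣m*n y (∣-trans (gcd[m,n]∣n c g′) g′∣Q′))
    where
    open ≡-Reasoning
    g g′ : ℕ
    g = gcd c (gcdList cs)
    g′ = gcdList cs
    shuffle₁ : ∀ y Q′ g′ → y * (Q′ + g′) ≡ y * g′ + y * Q′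
    shuffle₁ = solve-∀
    shuffle₂ : ∀ g a b → g + a + b ≡ a + b + g
    shuffle₂ = solve-∀

  -- With Q = q g and P = (q + 1) g, write t = a q + b (b < q ≤ a); then t g = (a - b) Q + b P.
  gap⇒large-multiples : ∀ {P Q g} → C P → C Q → P ≡ Q + g → g ∣ Q → ∃ λ K → ∀ t → K ≤ t → C (t * g)
  gap⇒large-multiples {P} {Q} {g} CP CQ P≡ (divides zero Q≡) =
    0 , λ t _ → subst C (cong (t *_) (trans P≡ (cong (_+ g) Q≡))) (C-* t CP)
  gap⇒large-multiples {P} {Q} {g} CP CQ P≡ (divides q@(suc _) Q≡) = q * q , large
    where
    large : ∀ t → q * q ≤ t → C (t * g)
    large t q²≤t = subst C t-decomposition (C-+ (C-* (a ∸ b) CQ) (C-* b CP))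
      where
      a b : ℕ
      a = t / q
      b = t % q
      b≤a : b ≤ a
      b≤a = ≤-trans (<⇒≤ (m%n<n t q)) (subst (_≤ a) (m*n/n≡m q q) (/-monoˡ-≤ q q²≤t))
      shuffle : ∀ c b q g → c * (q * g) + b * (q * g + g) ≡ (b + (c + b) * q) * g
      shuffle = solve-∀
      t-decomposition : (a ∸ b) * Q + b * P ≡ t * g
      t-decomposition = begin
        (a ∸ b) * Q + b * P
          ≡⟨ cong₂ (λ u v → (a ∸ b) * u + b * v) Q≡ (trans P≡ (cong (_+ g) Q≡)) ⟩
        (a ∸ b) * (q * g) + b * (q * g + g)    ≡⟨ shuffle (a ∸ b) b q g ⟩
        (b + ((a ∸ b) + b) * q) * g            ≡⟨ cong (λ z → (b + z * q) * g) (m∸n+n≡m b≤a) ⟩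
        (b + a * q) * g                        ≡⟨ cong (_* g) (m≡m%n+[m/n]*n t q) ⟨
        t * g                                  ∎
        where open ≡-Reasoning

  large-multiples-of-gcd : ∀ cs → All C cs → ∃ λ K → ∀ t → K ≤ t → C (t * gcdList cs)
  large-multiples-of-gcd cs Ccs with gcd-gap cs Ccs
  ... | _ , _ , CP , CQ , P≡ , g∣Q = gap⇒large-multiples CP CQ P≡ g∣Q

-- Diagonals

encode : ∀ {n m} → Vec (Fin n) m → Fin (n ^ m)
encode []      = zero
encode (a ∷ v) = combine a (encode v)

encode-injective : ∀ {n m} (u v : Vec (Fin n) m) → encode u ≡ encode v → u ≡ v
encode-injective []      []      _  = refl
encode-injective (a ∷ u) (b ∷ v) eq with combine-injective a (encode u) b (encode v) eq
... | refl , eq′ = cong (a ∷_) (encode-injective u v eq′)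

∈-allPerms⁺ : ∀ {n} {W : Tuple n} → IsPerm W → W ∈ allPerms n
∈-allPerms⁺ {W = W} = ∈-filter⁺ isPerm? (∈-allVecs W)

∈-allPerms⁻ : ∀ {n} {W : Tuple n} → W ∈ allPerms n → IsPerm W
∈-allPerms⁻ {n} W∈ = proj₂ (∈-filter⁻ isPerm? {xs = allVecs n} W∈)

module Diagonals {n : ℕ} (op : Op n) (qg : IsQuasigroup op) where

  open PointMass (_≟ᵛ_ {n} {n})

  infixl 7 _·_
  _·_ : Tuple n → Tuple n → Tuple n
  U · W = U ⟨ op ⟩ W

  Diagonal-refl : ∀ U → Diagonal op U U 0
  Diagonal-refl U = [] , refl , [] , refl

  Diagonal-step : ∀ U {W} → IsPerm W → Diagonal op U (U · W) 1
  Diagonal-step U {W} W-perm = W ∷ [] , refl , W-perm ∷ [] , refl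

  Diagonal-++ : ∀ {U V X a b} → Diagonal op U V a → Diagonal op V X b → Diagonal op U X (a + b)
  Diagonal-++ {U} (Ws , refl , Ws-perm , refl) (Ws′ , refl , Ws′-perm , refl) =
    Ws ++ Ws′ , length-++ Ws , ++⁺ Ws-perm Ws′-perm , foldl-++ _ U Ws Ws′

  Equiv-refl : ∀ U → Equiv op U U
  Equiv-refl U = 0 , Diagonal-refl U

  Equiv-trans : ∀ {U V X} → Equiv op U V → Equiv op V X → Equiv op U X
  Equiv-trans (a , U→V) (b , V→X) = a + b , Diagonal-++ U→V V→X

  T≡∑ : ∀ U V d → T op U V d ≡ ∑ (permSeqs n d) (λ Ws → 𝟙 (applySeq op U Ws ≟ᵛ V))
  T≡∑ U V d = length-filter≡∑𝟙 (λ Ws → applySeq op U Ws ≟ᵛ V) (permSeqs n d)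

  T-zero : ∀ U V → T op U V 0 ≡ δ U V
  T-zero U V = trans (T≡∑ U V 0) (+-identityʳ (δ U V))

  T-suc : ∀ U V d → T op U V (suc d) ≡ ∑ (allPerms n) (λ W → T op (U · W) V d)
  T-suc U V d = begin
    T op U V (suc d)
      ≡⟨ T≡∑ U V (suc d) ⟩
    ∑ (permSeqs n (suc d)) hits
      ≡⟨ ∑-concatMap _ (allPerms n) hits ⟩
    ∑ (allPerms n) (λ W → ∑ (map (W ∷_) (permSeqs n d)) hits)
      ≡⟨ ∑-cong (allPerms n) (λ W → trans (∑-map (W ∷_) (permSeqs n d) hits)
                                          (sym (T≡∑ (U · W) V d))) ⟩
    ∑ (allPerms n) (λ W → T op (U · W) V d) ∎
    where
    open ≡-Reasoning
    hits : List (Tuple n) → ℕ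
    hits Ws = 𝟙 (applySeq op U Ws ≟ᵛ V)

  T-+ : ∀ U V a b → T op U V (a + b) ≡ ∑ (allVecs n) (λ X → T op U X a * T op X V b)
  T-+ U V zero b = sym (begin
    ∑ (allVecs n) (λ X → T op U X 0 * T op X V b)
      ≡⟨ ∑-cong (allVecs n) (λ X → cong (_* T op X V b) (trans (T-zero U X) (δ-sym U X))) ⟩
    ∑ (allVecs n) (λ X → δ X U * T op X V b)        ≡⟨ ∑-δ (λ X → T op X V b) (allVecs⁺ n) (∈-allVecs U) ⟩
    T op U V b                                      ∎)
    where open ≡-Reasoning
  T-+ U V (suc a) b = begin
    T op U V (suc (a + b))
      ≡⟨ T-suc U V (a + b) ⟩
    ∑ (allPerms n) (λ W → T op (U · W) V (a + b))
      ≡⟨ ∑-cong (allPerms n) (λ W → T-+ (U · W) V a b) ⟩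
    ∑ (allPerms n) (λ W → ∑ (allVecs n) (λ X → T op (U · W) X a * T op X V b))
      ≡⟨ ∑-comm (allPerms n) (allVecs n) _ ⟩
    ∑ (allVecs n) (λ X → ∑ (allPerms n) (λ W → T op (U · W) X a * T op X V b))
      ≡⟨ ∑-cong (allVecs n) (λ X → trans (∑-*ʳ (allPerms n) (T op X V b) (λ W → T op (U · W) X a))
                                         (cong (_* T op X V b) (sym (T-suc U X a)))) ⟩
    ∑ (allVecs n) (λ X → T op U X (suc a) * T op X V b) ∎
    where open ≡-Reasoning

  ∑-δ-allVecs : ∀ U → ∑ (allVecs n) (λ X → δ X U) ≡ 1
  ∑-δ-allVecs U = trans (∑-cong (allVecs n) (λ X → sym (*-identityʳ (δ X U))))
                        (∑-δ (λ _ → 1) (allVecs⁺ n) (∈-allVecs U))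

  ∑-T-row : ∀ U d → ∑ (allVecs n) (λ X → T op U X d) ≡ (n !) ^ d
  ∑-T-row U zero = trans (∑-cong (allVecs n) (λ X → trans (T-zero U X) (δ-sym U X))) (∑-δ-allVecs U)
  ∑-T-row U (suc d) = begin
    ∑ (allVecs n) (λ X → T op U X (suc d))                          ≡⟨ ∑-cong (allVecs n) (λ X → T-suc U X d) ⟩
    ∑ (allVecs n) (λ X → ∑ (allPerms n) (λ W → T op (U · W) X d))   ≡⟨ ∑-comm (allVecs n) (allPerms n) _ ⟩
    ∑ (allPerms n) (λ W → ∑ (allVecs n) (λ X → T op (U · W) X d))
      ≡⟨ ∑-cong (allPerms n) (λ W → ∑-T-row (U · W) d) ⟩
    ∑ (allPerms n) (λ _ → (n !) ^ d)                                ≡⟨ ∑-const (allPerms n) _ ⟩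
    length (allPerms n) * (n !) ^ d                                 ≡⟨ cong (_* (n !) ^ d) (length-allPerms n) ⟩
    n ! * (n !) ^ d                                                 ∎
    where open ≡-Reasoning

  T≤ : ∀ U V d → T op U V d ≤ (n !) ^ d
  T≤ U V d = subst (T op U V d ≤_) (∑-T-row U d) (∈⇒≤∑ (allVecs n) (λ X → T op U X d) (∈-allVecs V))

  divʳ : ∀ {m} → Vec (Fin n) m → Vec (Fin n) m → Vec (Fin n) m
  divʳ []      []      = []
  divʳ (v ∷ V) (w ∷ W) = proj₁ (proj₂ qg w v) ∷ divʳ V W

  divʳ-· : ∀ {m} (V W : Vec (Fin n) m) → zipWith op (divʳ V W) W ≡ V
  divʳ-· []      []      = refl
  divʳ-· (v ∷ V) (w ∷ W) = cong₂ _∷_ (proj₁ (proj₂ (proj₂ qg w v))) (divʳ-· V W)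

  op-cancelʳ : ∀ {x y w} → op x w ≡ op y w → x ≡ y
  op-cancelʳ {x} {w = w} xw≡yw =
    let (_ , _ , unique) = proj₂ qg w (op x w) in trans (sym (unique refl)) (unique (sym xw≡yw))

  ·-cancelʳ : ∀ {m} (X Y W : Vec (Fin n) m) → zipWith op X W ≡ zipWith op Y W → X ≡ Y
  ·-cancelʳ []      []      []      _  = refl
  ·-cancelʳ (x ∷ X) (y ∷ Y) (w ∷ W) eq with ∷-injective eq
  ... | xw≡yw , XW≡YW = cong₂ _∷_ (op-cancelʳ xw≡yw) (·-cancelʳ X Y W XW≡YW)

  δ-·ʳ : ∀ X W V → δ (X · W) V ≡ δ X (divʳ V W)
  δ-·ʳ X W V with (X · W) ≟ᵛ V | X ≟ᵛ divʳ V W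
  ... | yes _     | yes _  = refl
  ... | no  _     | no  _  = refl
  ... | yes XW≡V  | no X≢  = contradiction (·-cancelʳ X (divʳ V W) W (trans XW≡V (sym (divʳ-· V W)))) X≢
  ... | no  XW≢V  | yes refl = contradiction (divʳ-· V W) XW≢V

  ∑-T-column₁ : ∀ V → ∑ (allVecs n) (λ X → T op X V 1) ≡ n !
  ∑-T-column₁ V = begin
    ∑ (allVecs n) (λ X → T op X V 1)                              ≡⟨ ∑-cong (allVecs n) (λ X → T-suc X V 0) ⟩
    ∑ (allVecs n) (λ X → ∑ (allPerms n) (λ W → T op (X · W) V 0)) ≡⟨ ∑-comm (allVecs n) (allPerms n) _ ⟩
    ∑ (allPerms n) (λ W → ∑ (allVecs n) (λ X → T op (X · W) V 0))
      ≡⟨ ∑-cong (allPerms n) (λ W → trans (∑-cong (allVecs n) (λ X → trans (T-zero (X · W) V) (δ-·ʳ X W V)))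
                                          (∑-δ-allVecs (divʳ V W))) ⟩
    ∑ (allPerms n) (λ _ → 1)
      ≡⟨ trans (∑-const (allPerms n) 1) (*-identityʳ _) ⟩
    length (allPerms n)                                           ≡⟨ length-allPerms n ⟩
    n !                                                           ∎
    where open ≡-Reasoning

  ∑-T-column : ∀ V d → ∑ (allVecs n) (λ X → T op X V d) ≡ (n !) ^ d
  ∑-T-column V zero = trans (∑-cong (allVecs n) (λ X → T-zero X V)) (∑-δ-allVecs V)
  ∑-T-column V (suc d) = begin
    ∑ (allVecs n) (λ X → T op X V (suc d))
      ≡⟨ ∑-cong (allVecs n) (λ X → cong (T op X V) (+-comm 1 d)) ⟩
    ∑ (allVecs n) (λ X → T op X V (d + 1))                         ≡⟨ ∑-cong (allVecs n) (λ X → T-+ X V d 1) ⟩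
    ∑ (allVecs n) (λ X → ∑ (allVecs n) (λ Y → T op X Y d * T op Y V 1))
      ≡⟨ ∑-comm (allVecs n) (allVecs n) _ ⟩
    ∑ (allVecs n) (λ Y → ∑ (allVecs n) (λ X → T op X Y d * T op Y V 1))
      ≡⟨ ∑-cong (allVecs n) (λ Y → trans (∑-*ʳ (allVecs n) (T op Y V 1) (λ X → T op X Y d))
                                         (cong (_* T op Y V 1) (∑-T-column Y d))) ⟩
    ∑ (allVecs n) (λ Y → (n !) ^ d * T op Y V 1)
      ≡⟨ ∑-*ˡ (allVecs n) ((n !) ^ d) (λ Y → T op Y V 1) ⟩
    (n !) ^ d * ∑ (allVecs n) (λ Y → T op Y V 1)                  ≡⟨ cong ((n !) ^ d *_) (∑-T-column₁ V) ⟩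
    (n !) ^ d * n !                                               ≡⟨ *-comm ((n !) ^ d) (n !) ⟩
    n ! * (n !) ^ d                                               ∎
    where open ≡-Reasoning

  Diagonal⇒T>0 : ∀ {U V d} → Diagonal op U V d → 0 < T op U V d
  Diagonal⇒T>0 {U} ([] , refl , [] , refl) = subst (0 <_) (sym (trans (T-zero U U) (δ-refl U))) (s≤s z≤n)
  Diagonal⇒T>0 {U} {V} (W ∷ Ws , refl , W-perm ∷ Ws-perm , UWs≡V) =
    subst (0 <_) (sym (T-suc U V (length Ws)))
      (<-≤-trans (Diagonal⇒T>0 (Ws , refl , Ws-perm , UWs≡V))
                 (∈⇒≤∑ (allPerms n) (λ W′ → T op (U · W′) V (length Ws)) (∈-allPerms⁺ W-perm)))

  T>0⇒Diagonal : ∀ U V d → 0 < T op U V d → Diagonal op U V d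
  T>0⇒Diagonal U V zero T>0 = [] , refl , [] , 𝟙-positive (U ≟ᵛ V) (subst (0 <_) (T-zero U V) T>0)
  T>0⇒Diagonal U V (suc d) T>0 with ∑-positive (allPerms n) _ (subst (0 <_) (T-suc U V d) T>0)
  ... | W , W∈ , T>0′ with T>0⇒Diagonal (U · W) V d T>0′
  ...   | Ws , refl , Ws-perm , UWWs≡V = W ∷ Ws , refl , ∈-allPerms⁻ W∈ ∷ Ws-perm , UWWs≡V

  ¬Diagonal⇒T≡0 : ∀ {U V d} → ¬ Diagonal op U V d → T op U V d ≡ 0
  ¬Diagonal⇒T≡0 {U} {V} {d} ¬diag = n≤0⇒n≡0 (≮⇒≥ (¬diag ∘ T>0⇒Diagonal U V d))

  power : Tuple n → ℕ → Tuple n → Tuple n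
  power W zero    X = X
  power W (suc k) X = power W k (X · W)

  Diagonal-power : ∀ {W} → IsPerm W → ∀ k X → Diagonal op X (power W k X) k
  Diagonal-power {W} W-perm k X = replicate k W , length-replicate k , all-perm k , applies k X
    where
    all-perm : ∀ k → All IsPerm (replicate k W)
    all-perm zero    = []
    all-perm (suc k) = W-perm ∷ all-perm k
    applies : ∀ k X → applySeq op X (replicate k W) ≡ power W k X
    applies zero    X = refl
    applies (suc k) X = applies k (X · W)

  power-+ : ∀ W a b X → power W (a + b) X ≡ power W b (power W a X)
  power-+ W zero    b X = refl
  power-+ W (suc a) b X = power-+ W a b (X · W)

  power-cancel : ∀ W a X Y → power W a X ≡ power W a Y → X ≡ Y
  power-cancel W zero    X Y eq = eq
  power-cancel W (suc a) X Y eq = ·-cancelʳ X Y W (power-cancel W a (X · W) (Y · W) eq)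

  -- Pigeonhole: the orbit of X under · W is periodic, so repeating · W leads from X · W back to X.
  Equiv-back : ∀ {W} → IsPerm W → ∀ X → Equiv op (X · W) X
  Equiv-back {W} W-perm X with pigeonhole (n<1+n (n ^ n)) (λ i → encode (power W (toℕ i) X))
  ... | i , j , i<j , same-code = back (toℕ j ∸ toℕ i) (m<n⇒0<n∸m i<j) X≡power
    where
    X≡power : X ≡ power W (toℕ j ∸ toℕ i) X
    X≡power = power-cancel W (toℕ i) X _ (trans (encode-injective _ _ same-code)
      (trans (cong (λ k → power W k X) (sym (m∸n+n≡m (<⇒≤ i<j)))) (power-+ W (toℕ j ∸ toℕ i) (toℕ i) X)))
    back : ∀ e → 0 < e → X ≡ power W e X → Equiv op (X · W) X
    back (suc e) _ X≡ = e , subst (λ Y → Diagonal op (X · W) Y e) (sym X≡) (Diagonal-power W-perm e (X · W))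

  Diagonal-reverse : ∀ {U V d} → Diagonal op U V d → Equiv op V U
  Diagonal-reverse ([] , refl , [] , refl) = Equiv-refl _
  Diagonal-reverse {U} (W ∷ Ws , refl , W-perm ∷ Ws-perm , UWWs≡V) =
    Equiv-trans (Diagonal-reverse (Ws , refl , Ws-perm , UWWs≡V)) (Equiv-back W-perm U)

  Equiv-sym : ∀ {U V} → Equiv op U V → Equiv op V U
  Equiv-sym (_ , U→V) = Diagonal-reverse U→V

-- Units

module Units {n : ℕ} (op : Op n) (qg : IsQuasigroup op) (τ′ : ℕ) (U : Tuple n)
  (label : Tuple n → Fin (suc τ′)) (label-shift : IsUnitLabelling op U (suc τ′) label) (s : ℕ)
  (unit : ∀ j → UnitHasSize op U (suc τ′) label j s) (period : IsPeriod op U (suc τ′)) where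

  open Diagonals op qg
  open import Data.List.Membership.DecPropositional (_≟ᵛ_ {n} {n}) using (_∈?_)

  τ : ℕ
  τ = suc τ′

  unitList : Fin τ → List (Tuple n)
  unitList j = proj₁ (unit j)

  ∈-unit⁻ : ∀ {j Z} → Z ∈ unitList j → Equiv op U Z × label Z ≡ j
  ∈-unit⁻ {j} {Z} = Equivalence.to (proj₁ (proj₂ (proj₂ (unit j))) Z)

  ∈-unit⁺ : ∀ {j Z} → Equiv op U Z → label Z ≡ j → Z ∈ unitList j
  ∈-unit⁺ {j} {Z} U~Z refl = Equivalence.from (proj₁ (proj₂ (proj₂ (unit j))) Z) (U~Z , refl)

  class : List (Tuple n)
  class = concatMap unitList (allFin τ)

  ∈-class⁻ : ∀ {Z} → Z ∈ class → Equiv op U Z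
  ∈-class⁻ Z∈ = proj₁ (∈-unit⁻ (proj₂ (proj₂ (find (∈-concatMap⁻ unitList {xs = allFin τ} Z∈)))))

  ∈-class⁺ : ∀ {Z} → Equiv op U Z → Z ∈ class
  ∈-class⁺ {Z} U~Z = ∈-concatMap⁺ unitList (Any.map (λ { refl → ∈-unit⁺ U~Z refl }) (∈-allFin (label Z)))

  -- Lengths of chosen diagonals U → Z and Z → U, with the junk value 0 outside the class.
  dist⁺ dist⁻ : Tuple n → ℕ
  dist⁺ Z with Z ∈? class
  ... | yes Z∈ = proj₁ (∈-class⁻ Z∈)
  ... | no _   = 0
  dist⁻ Z with Z ∈? class
  ... | yes Z∈ = proj₁ (Equiv-sym (∈-class⁻ Z∈))
  ... | no _   = 0

  dist⁺-path : ∀ {Z} → Z ∈ class → Diagonal op U Z (dist⁺ Z)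
  dist⁺-path {Z} Z∈ with Z ∈? class
  ... | yes Z∈′ = proj₂ (∈-class⁻ Z∈′)
  ... | no Z∉   = contradiction Z∈ Z∉

  dist⁻-path : ∀ {Z} → Z ∈ class → Diagonal op Z U (dist⁻ Z)
  dist⁻-path {Z} Z∈ with Z ∈? class
  ... | yes Z∈′ = proj₂ (Equiv-sym (∈-class⁻ Z∈′))
  ... | no Z∉   = contradiction Z∈ Z∉

  ·-class : ∀ {X W} → X ∈ class → IsPerm W → X · W ∈ class
  ·-class X∈ W-perm = ∈-class⁺ (Equiv-trans (∈-class⁻ X∈) (1 , Diagonal-step _ W-perm))

  loops-via : Tuple n → List ℕ
  loops-via X = (dist⁺ X + dist⁻ X) ∷ map (λ W → dist⁺ X + 1 + dist⁻ (X · W)) (allPerms n)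

  loops : List ℕ
  loops = concatMap loops-via class

  loops-are-loops : All (Diagonal op U U) loops
  loops-are-loops = All.tabulate λ ℓ∈ → loop (find (∈-concatMap⁻ loops-via {xs = class} ℓ∈))
    where
    loop : ∀ {ℓ} → ∃ (λ X → X ∈ class × ℓ ∈ loops-via X) → Diagonal op U U ℓ
    loop (X , X∈ , here refl) = Diagonal-++ (dist⁺-path X∈) (dist⁻-path X∈)
    loop (X , X∈ , there ℓ∈) with ∈-map⁻ _ ℓ∈
    ... | W , W∈ , refl =
      Diagonal-++ (Diagonal-++ (dist⁺-path X∈) (Diagonal-step X W-perm)) (dist⁻-path (·-class X∈ W-perm))
      where
      W-perm : IsPerm W
      W-perm = ∈-allPerms⁻ W∈

  g : ℕ
  g = gcdList loops

  g∣loops-via : ∀ {X ℓ} → X ∈ class → ℓ ∈ loops-via X → g ∣ ℓ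
  g∣loops-via X∈ ℓ∈ = All.lookup (gcdList-∣ loops) (∈-concatMap⁺ loops-via (Any.map (λ { refl → ℓ∈ }) X∈))

  -- dist⁺ is a potential modulo g: every step raises it by one.
  dist⁺-step : ∀ {X W} → X ∈ class → IsPerm W → dist⁺ X + 1 ≡ dist⁺ (X · W) mod g
  dist⁺-step {X} {W} X∈ W-perm = +-cancelʳ-mod (dist⁻ (X · W)) (≡-mod-trans
    (∣⇒≡0-mod (g∣loops-via X∈ (there (∈-map⁺ _ (∈-allPerms⁺ W-perm)))))
    (≡-mod-sym (∣⇒≡0-mod (g∣loops-via (·-class X∈ W-perm) (here refl)))))

  dist⁺-walk : ∀ {X Y d} → X ∈ class → Diagonal op X Y d → dist⁺ X + d ≡ dist⁺ Y mod g
  dist⁺-walk {X} X∈ ([] , refl , [] , refl) = ≡⇒≡-mod (+-identityʳ (dist⁺ X))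
  dist⁺-walk {X} X∈ (W ∷ Ws , refl , W-perm ∷ Ws-perm , XWWs≡Y) = ≡-mod-trans
    (subst (λ k → k ≡ dist⁺ (X · W) + length Ws mod g) (+-assoc (dist⁺ X) 1 (length Ws))
      (+-cong-mod (dist⁺-step X∈ W-perm) (≡⇒≡-mod refl)))
    (dist⁺-walk (·-class X∈ W-perm) (Ws , refl , Ws-perm , XWWs≡Y))

  g∣cycle : ∀ d → CycleLength op U d → g ∣ d
  g∣cycle d (_ , Z , U~Z , Z→Z) = ≡0-mod⇒∣ (+-cancelˡ-mod (dist⁺ Z)
    (≡-mod-trans (dist⁺-walk (∈-class⁺ U~Z) Z→Z) (≡⇒≡-mod (sym (+-identityʳ (dist⁺ Z))))))

  g∣τ : g ∣ τ
  g∣τ = proj₂ period g g∣cycle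

  g-nonZero : NonZero g
  g-nonZero = ≢-nonZero λ g≡0 → 0≢1+n (sym (0∣⇒≡0 (subst (_∣ τ) g≡0 g∣τ)))

  label-shift-mod : ∀ {Z Z′ d} → Equiv op U Z → Equiv op U Z′ → Diagonal op Z Z′ d →
                    toℕ (label Z) + d ≡ toℕ (label Z′) mod τ
  label-shift-mod U~Z U~Z′ Z→Z′ = CongMod⇒≡-mod (label-shift _ _ _ U~Z U~Z′ Z→Z′)

  label-injective : ∀ {i j : Fin τ} → toℕ i ≡ toℕ j mod τ → i ≡ j
  label-injective {i} {j} i≡j = toℕ-injective
    (trans (sym (m<n⇒m%n≡m (toℕ<n i))) (trans (≡-mod⇒%≡ i≡j) (m<n⇒m%n≡m (toℕ<n j))))

  same-label⇒τ∣ : ∀ {A B d} → Equiv op U A → Equiv op U B → label A ≡ label B → Diagonal op A B d → τ ∣ d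
  same-label⇒τ∣ {A} U~A U~B lA≡lB A→B = ≡0-mod⇒∣ (+-cancelˡ-mod (toℕ (label A))
    (≡-mod-trans (label-shift-mod U~A U~B A→B) (≡⇒≡-mod (trans (cong toℕ (sym lA≡lB)) (sym (+-identityʳ _))))))

  home : List (Tuple n)
  home = unitList (label U)

  home-unique : Unique home
  home-unique = proj₁ (proj₂ (unit (label U)))

  length-home : length home ≡ s
  length-home = proj₂ (proj₂ (proj₂ (unit (label U))))

  U∈home : U ∈ home
  U∈home = ∈-unit⁺ (Equiv-refl U) refl

  home⊆class : ∀ {A} → A ∈ home → A ∈ class
  home⊆class A∈ = ∈-class⁺ (proj₁ (∈-unit⁻ A∈))

  home-closed : ∀ {A B d} → A ∈ home → Diagonal op A B d → d ≡ 0 mod τ → B ∈ home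
  home-closed {A} {B} {d} A∈ A→B d≡0 = ∈-unit⁺ U~B (label-injective (≡-mod-trans
    (≡-mod-sym (label-shift-mod U~A U~B A→B))
    (≡-mod-trans (+-cong-mod (≡⇒≡-mod (cong toℕ lA≡lU)) d≡0) (≡⇒≡-mod (+-identityʳ _)))))
    where
    U~A : Equiv op U A
    U~A = proj₁ (∈-unit⁻ A∈)
    lA≡lU : label A ≡ label U
    lA≡lU = proj₂ (∈-unit⁻ A∈)
    U~B : Equiv op U B
    U~B = Equiv-trans U~A (d , A→B)

  Diagonal-length-mod : ∀ {V d e} → Diagonal op U V d → Diagonal op U V e → d ≡ e mod τ
  Diagonal-length-mod {V} U→V U→V′ = +-cancelˡ-mod (toℕ (label U)) (≡-mod-trans
    (label-shift-mod (Equiv-refl U) (_ , U→V) U→V)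
    (≡-mod-sym (label-shift-mod (Equiv-refl U) (_ , U→V) U→V′)))

  Diagonal-source-home : ∀ {B V d e} → Diagonal op B V d → Diagonal op U V e → d ≡ e mod τ → B ∈ home
  Diagonal-source-home {B} {V} {d} B→V U→V d≡e = ∈-unit⁺ U~B (label-injective (+-cancelʳ-mod d (≡-mod-trans
    (label-shift-mod U~B U~V B→V)
    (≡-mod-trans (≡-mod-sym (label-shift-mod (Equiv-refl U) U~V U→V)) (+-cong-mod (≡⇒≡-mod refl) (≡-mod-sym d≡e))))))
    where
    U~V : Equiv op U V
    U~V = _ , U→V
    U~B : Equiv op U B
    U~B = Equiv-trans U~V (Diagonal-reverse B→V)

  -- Walk A → U (a multiple of τ), loop at U for a large multiple of g, then walk U → B.
  mixing : ∃ λ m → 0 < m × τ ∣ m × (∀ {A B} → A ∈ home → B ∈ home → Diagonal op A B m)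
  mixing = τ * M , ≤-trans (s≤s z≤n) (≤-trans (m≤n+m (suc (K * g)) bound) (m≤n*m M τ)) , m∣m*n M , mix
    where
    open AdditiveSubmonoid (Diagonal op U U) (Diagonal-refl U) Diagonal-++
    K : ℕ
    K = proj₁ (large-multiples-of-gcd loops loops-are-loops)
    loop : ∀ t → K ≤ t → Diagonal op U U (t * g)
    loop = proj₂ (large-multiples-of-gcd loops loops-are-loops)
    bound M : ℕ
    bound = ∑ class dist⁻ + ∑ class dist⁺
    M = bound + suc (K * g)
    mix : ∀ {A B} → A ∈ home → B ∈ home → Diagonal op A B (τ * M)
    mix {A} {B} A∈ B∈ =
      subst (Diagonal op A B) total
        (Diagonal-++ (dist⁻-path (home⊆class A∈)) (Diagonal-++ (loop t K≤t) (dist⁺-path (home⊆class B∈))))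
      where
      c : ℕ
      c = dist⁻ A + dist⁺ B
      τ∣c : τ ∣ c
      τ∣c = ∣m∣n⇒∣m+n
        (same-label⇒τ∣ (proj₁ (∈-unit⁻ A∈)) (Equiv-refl U) (proj₂ (∈-unit⁻ A∈)) (dist⁻-path (home⊆class A∈)))
        (same-label⇒τ∣ (Equiv-refl U) (proj₁ (∈-unit⁻ B∈)) (sym (proj₂ (∈-unit⁻ B∈))) (dist⁺-path (home⊆class B∈)))
      c≤bound : c ≤ bound
      c≤bound = +-mono-≤ (∈⇒≤∑ class dist⁻ (home⊆class A∈)) (∈⇒≤∑ class dist⁺ (home⊆class B∈))
      M≤τM : M ≤ τ * M
      M≤τM = m≤n*m M τ
      c≤τM : c ≤ τ * M
      c≤τM = ≤-trans c≤bound (≤-trans (m≤m+n bound _) M≤τM)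
      g∣rest : g ∣ τ * M ∸ c
      g∣rest = ∣m+n∣m⇒∣n (subst (g ∣_) (sym (m+[n∸m]≡n c≤τM)) (∣-trans g∣τ (m∣m*n M))) (∣-trans g∣τ τ∣c)
      t : ℕ
      t = quotient g∣rest
      rest≡t*g : τ * M ∸ c ≡ t * g
      rest≡t*g = m∣n⇒n≡quotient*m g∣rest
      K≤t : K ≤ t
      K≤t = *-cancelʳ-≤ K t g {{g-nonZero}} (begin
        K * g                 ≤⟨ n≤1+n (K * g) ⟩
        suc (K * g)           ≡⟨ m+n∸m≡n bound (suc (K * g)) ⟨
        M ∸ bound             ≤⟨ ∸-mono M≤τM c≤bound ⟩
        τ * M ∸ c             ≡⟨ rest≡t*g ⟩
        t * g                 ∎)
        where open ≤-Reasoning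
      total : dist⁻ A + (t * g + dist⁺ B) ≡ τ * M
      total = begin
        dist⁻ A + (t * g + dist⁺ B)       ≡⟨ cong (λ x → dist⁻ A + (x + dist⁺ B)) rest≡t*g ⟨
        dist⁻ A + (τ * M ∸ c + dist⁺ B)   ≡⟨ shuffle (dist⁻ A) (τ * M ∸ c) (dist⁺ B) ⟩
        τ * M ∸ c + c                     ≡⟨ m∸n+n≡m c≤τM ⟩
        τ * M                             ∎
        where
        open ≡-Reasoning
        shuffle : ∀ a b c → a + (b + c) ≡ b + (a + c)
        shuffle = solve-∀

-- Estimates

∣-∣≤width : ∀ {L W a b} → L ≤ a → a ≤ L + W → L ≤ b → b ≤ L + W → ∣ a - b ∣ ≤ W
∣-∣≤width {L} {W} {a} {b} L≤a a≤L+W L≤b b≤L+W with ≤-total a b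
... | inj₁ a≤b = subst (_≤ W) (sym (m≤n⇒∣m-n∣≡n∸m a≤b)) (≤-trans (∸-mono b≤L+W L≤a) (≤-reflexive (m+n∸m≡n L W)))
... | inj₂ b≤a = subst (_≤ W) (sym (trans (∣-∣-comm a b) (m≤n⇒∣m-n∣≡n∸m b≤a)))
                   (≤-trans (∸-mono a≤L+W L≤b) (≤-reflexive (m+n∸m≡n L W)))

-- Averaging with weights t ≥ 1 over values in [lo, lo + D]: the excess weight E = ∑ (t - 1)
-- is all that spreads the result, which then lies in an interval of width E D.
∑-weighted-bounds : {A : Set} (xs : List A) (t x : A → ℕ) (lo D : ℕ) →
  (∀ a → a ∈ xs → 1 ≤ t a) → (∀ a → a ∈ xs → lo ≤ x a × x a ≤ lo + D) →
  let E = ∑ xs (λ a → t a ∸ 1) in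
  ∑ xs x + lo * E ≤ ∑ xs (λ a → t a * x a) × ∑ xs (λ a → t a * x a) ≤ ∑ xs x + lo * E + E * D
∑-weighted-bounds xs t x lo D t≥1 x-bounds = lower , upper
  where
  open ≤-Reasoning
  E : ℕ
  E = ∑ xs (λ a → t a ∸ 1)
  split : ∀ a → a ∈ xs → t a * x a ≡ x a + (t a ∸ 1) * x a
  split a a∈xs with t a | t≥1 a a∈xs
  ... | suc _ | _ = refl
  termwise-lower : ∀ a → a ∈ xs → x a + lo * (t a ∸ 1) ≤ t a * x a
  termwise-lower a a∈xs = begin
    x a + lo * (t a ∸ 1)    ≡⟨ cong (x a +_) (*-comm lo (t a ∸ 1)) ⟩
    x a + (t a ∸ 1) * lo    ≤⟨ +-monoʳ-≤ (x a) (*-monoʳ-≤ (t a ∸ 1) (proj₁ (x-bounds a a∈xs))) ⟩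
    x a + (t a ∸ 1) * x a   ≡⟨ split a a∈xs ⟨
    t a * x a               ∎
  termwise-upper : ∀ a → a ∈ xs → t a * x a ≤ x a + (lo * (t a ∸ 1) + (t a ∸ 1) * D)
  termwise-upper a a∈xs = begin
    t a * x a                               ≡⟨ split a a∈xs ⟩
    x a + (t a ∸ 1) * x a                   ≤⟨ +-monoʳ-≤ (x a) (*-monoʳ-≤ (t a ∸ 1) (proj₂ (x-bounds a a∈xs))) ⟩
    x a + (t a ∸ 1) * (lo + D)              ≡⟨ cong (x a +_) (distrib (t a ∸ 1) lo D) ⟩
    x a + (lo * (t a ∸ 1) + (t a ∸ 1) * D)  ∎
    where
    distrib : ∀ u lo D → u * (lo + D) ≡ lo * u + u * D
    distrib = solve-∀
  lower : ∑ xs x + lo * E ≤ ∑ xs (λ a → t a * x a)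
  lower = begin
    ∑ xs x + lo * E                          ≡⟨ cong (∑ xs x +_) (∑-*ˡ xs lo (λ a → t a ∸ 1)) ⟨
    ∑ xs x + ∑ xs (λ a → lo * (t a ∸ 1))     ≡⟨ ∑-+ xs x _ ⟨
    ∑ xs (λ a → x a + lo * (t a ∸ 1))        ≤⟨ ∑-mono-≤ xs termwise-lower ⟩
    ∑ xs (λ a → t a * x a)                   ∎
  upper : ∑ xs (λ a → t a * x a) ≤ ∑ xs x + lo * E + E * D
  upper = begin
    ∑ xs (λ a → t a * x a)                                            ≤⟨ ∑-mono-≤ xs termwise-upper ⟩
    ∑ xs (λ a → x a + (lo * (t a ∸ 1) + (t a ∸ 1) * D))               ≡⟨ ∑-+ xs x _ ⟩
    ∑ xs x + ∑ xs (λ a → lo * (t a ∸ 1) + (t a ∸ 1) * D)              ≡⟨ cong (∑ xs x +_) (∑-+ xs _ _) ⟩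
    ∑ xs x + (∑ xs (λ a → lo * (t a ∸ 1)) + ∑ xs (λ a → (t a ∸ 1) * D))
      ≡⟨ cong₂ (λ u v → ∑ xs x + (u + v)) (∑-*ˡ xs lo _) (∑-*ʳ xs D _) ⟩
    ∑ xs x + (lo * E + E * D)                                         ≡⟨ +-assoc (∑ xs x) _ _ ⟨
    ∑ xs x + lo * E + E * D                                           ∎

bernoulli : ∀ E s j → E ^ j * (E + j * s) ≤ (E + s) ^ j * E
bernoulli E s zero = ≤-reflexive (base E s)
  where
  base : ∀ E s → 1 * (E + 0 * s) ≡ 1 * E
  base = solve-∀
bernoulli E s (suc j) = begin
  E * E ^ j * (E + suc j * s)                        ≡⟨ expand E (E ^ j) j s ⟩
  E * (E ^ j * (E + j * s)) + E ^ j * E * s          ≤⟨ +-mono-≤ (*-monoʳ-≤ E (bernoulli E s j))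
                                                          (*-monoˡ-≤ s (*-monoˡ-≤ E (^-monoˡ-≤ j (m≤m+n E s)))) ⟩
  E * ((E + s) ^ j * E) + (E + s) ^ j * E * s        ≡⟨ collect E ((E + s) ^ j) s ⟩
  (E + s) * (E + s) ^ j * E                          ∎
  where
  open ≤-Reasoning
  expand : ∀ E e j s → E * e * (E + suc j * s) ≡ E * (e * (E + j * s)) + e * E * s
  expand = solve-∀
  collect : ∀ E f s → E * (f * E) + f * E * s ≡ (E + s) * f * E
  collect = solve-∀

geometric-gap : ∀ E s D j → 1 ≤ s → D * E + 1 ≤ j → s * D * E ^ j < (E + s) ^ j
geometric-gap zero s D zero _ D*0+1≤0 = contradiction (≤-trans (m≤n+m 1 (D * 0)) D*0+1≤0) λ ()
geometric-gap zero s D (suc j) 1≤s _ =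
  subst (_< s ^ suc j) (sym (*-zeroʳ (s * D))) (m^n>0 s {{>-nonZero 1≤s}} (suc j))
geometric-gap E@(suc _) s D j 1≤s DE<j = *-cancelʳ-< E (s * D * E ^ j) ((E + s) ^ j) (begin-strict
  s * D * E ^ j * E      ≡⟨ shuffle s D (E ^ j) E ⟩
  E ^ j * (s * D * E)    <⟨ *-monoʳ-< (E ^ j) {{m^n≢0 E j}} sDE<E+js ⟩
  E ^ j * (E + j * s)    ≤⟨ bernoulli E s j ⟩
  (E + s) ^ j * E        ∎)
  where
  open ≤-Reasoning
  shuffle : ∀ s D f E → s * D * f * E ≡ f * (s * D * E)
  shuffle = solve-∀
  sDE<E+js : s * D * E < E + j * s
  sDE<E+js = begin-strict
    s * D * E          ≡⟨ shuffle₁ s D E ⟩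
    D * E * s          <⟨ m<n+m (D * E * s) 1≤s ⟩
    s + D * E * s      ≡⟨ shuffle₂ s D E ⟩
    (D * E + 1) * s    ≤⟨ *-monoˡ-≤ s DE<j ⟩
    j * s              ≤⟨ m≤n+m (j * s) E ⟩
    E + j * s          ∎
    where
    shuffle₁ : ∀ s D E → s * D * E ≡ D * E * s
    shuffle₁ = solve-∀
    shuffle₂ : ∀ s D E → s + D * E * s ≡ (D * E + 1) * s
    shuffle₂ = solve-∀

toℚᵘ-ℕtoℚ : ∀ m → toℚᵘ (ℕtoℚ m) ≃ mkℚᵘ (ℤ.+ m) 0
toℚᵘ-ℕtoℚ m rewrite ℚ.normalize-coprime (Coprimality.sym (Coprimality.1-coprimeTo m)) = ℚᵘ.≃-refl

∣⊖∣≡∣-∣ : ∀ x y → ℤ.∣ x ℤ.⊖ y ∣ ≡ ∣ x - y ∣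
∣⊖∣≡∣-∣ x y with ≤-total x y
... | inj₁ x≤y = trans (ℤ.∣⊖∣-≤ x≤y) (sym (m≤n⇒∣m-n∣≡n∸m x≤y))
... | inj₂ y≤x = trans (ℤ.∣m⊖n∣≡∣n⊖m∣ x y) (trans (ℤ.∣⊖∣-≤ y≤x) (sym (trans (∣-∣-comm x y) (m≤n⇒∣m-n∣≡n∸m y≤x))))

∣-∣ᵘ : ∀ x y → ℚᵘ.∣ mkℚᵘ (ℤ.+ x) 0 ℚᵘ.- mkℚᵘ (ℤ.+ y) 0 ∣ ≃ mkℚᵘ (ℤ.+ ∣ x - y ∣) 0
∣-∣ᵘ x y = *≡* (begin
  ℤ.+ ℤ.∣ ℤ.+ x ℤ.* ℤ.+ 1 ℤ.+ ℤ.- ℤ.+ y ℤ.* ℤ.+ 1 ∣ ℤ.* ℤ.+ 1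
    ≡⟨ ℤ.*-identityʳ _ ⟩
  ℤ.+ ℤ.∣ ℤ.+ x ℤ.* ℤ.+ 1 ℤ.+ ℤ.- ℤ.+ y ℤ.* ℤ.+ 1 ∣
    ≡⟨ cong (λ z → ℤ.+ ℤ.∣ z ∣) (trans (cong₂ ℤ._+_ (ℤ.*-identityʳ (ℤ.+ x)) (ℤ.*-identityʳ (ℤ.- ℤ.+ y))) (ℤ.m-n≡m⊖n x y)) ⟩
  ℤ.+ ℤ.∣ x ℤ.⊖ y ∣
    ≡⟨ cong ℤ.+_ (∣⊖∣≡∣-∣ x y) ⟩
  ℤ.+ ∣ x - y ∣
    ≡⟨ ℤ.*-identityʳ _ ⟨
  ℤ.+ ∣ x - y ∣ ℤ.* ℤ.+ 1 ∎)
  where open ≡-Reasoning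

-- For ε = (k+1)/(d+1) the integer D = d + 1 works.
relative-error-ℚ : ∀ ε → 0ℚ ℚ.< ε → ∃ λ D → ∀ x y → ∣ x - y ∣ * D < y →
                   ℚ.∣ ℕtoℚ x ℚ.- ℕtoℚ y ∣ ℚ.< ε ℚ.* ℕtoℚ y
relative-error-ℚ (mkℚ (ℤ.+ zero) _ _) (ℚ.*<* (ℤ.+<+ ()))
relative-error-ℚ (mkℚ ℤ.-[1+ _ ] _ _) (ℚ.*<* ())
relative-error-ℚ ε@(mkℚ ℤ.+[1+ k ] d _) _ = suc d , λ x y ∣x-y∣*D<y →
  ℚ.toℚᵘ-cancel-< (ℚᵘ.<-respˡ-≃ (ℚᵘ.≃-sym (lhs x y)) (ℚᵘ.<-respʳ-≃ (ℚᵘ.≃-sym (rhs y)) (core x y ∣x-y∣*D<y)))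
  where
  lhs : ∀ x y → toℚᵘ (ℚ.∣ ℕtoℚ x ℚ.- ℕtoℚ y ∣) ≃ mkℚᵘ (ℤ.+ ∣ x - y ∣) 0
  lhs x y = ℚᵘ.≃-trans (ℚ.toℚᵘ-homo-∣-∣ (ℕtoℚ x ℚ.- ℕtoℚ y))
    (ℚᵘ.≃-trans (ℚᵘ.∣-∣-cong (ℚᵘ.≃-trans (ℚ.toℚᵘ-homo-+ (ℕtoℚ x) (ℚ.- ℕtoℚ y))
        (ℚᵘ.+-cong (toℚᵘ-ℕtoℚ x) (ℚᵘ.≃-trans (ℚ.toℚᵘ-homo‿- (ℕtoℚ y)) (ℚᵘ.-‿cong (toℚᵘ-ℕtoℚ y))))))
      (∣-∣ᵘ x y))
  rhs : ∀ y → toℚᵘ (ε ℚ.* ℕtoℚ y) ≃ mkℚᵘ ℤ.+[1+ k ] d ℚᵘ.* mkℚᵘ (ℤ.+ y) 0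
  rhs y = ℚᵘ.≃-trans (ℚ.toℚᵘ-homo-* ε (ℕtoℚ y)) (ℚᵘ.*-cong (ℚᵘ.≃-refl {mkℚᵘ ℤ.+[1+ k ] d}) (toℚᵘ-ℕtoℚ y))
  core : ∀ x y → ∣ x - y ∣ * suc d < y → mkℚᵘ (ℤ.+ ∣ x - y ∣) 0 ℚᵘ.< mkℚᵘ ℤ.+[1+ k ] d ℚᵘ.* mkℚᵘ (ℤ.+ y) 0
  core x y ∣x-y∣*D<y = *<* (subst₂ ℤ._<_
    (ℤ.pos-* ∣ x - y ∣ (suc d * 1))
    (trans (ℤ.pos-* (suc k * y) 1) (cong (ℤ._* ℤ.+ 1) (ℤ.pos-* (suc k) y)))
    (ℤ.+<+ (subst₂ _<_ (sym (cong (∣ x - y ∣ *_) (*-identityʳ (suc d)))) (sym (*-identityʳ _))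
             (<-≤-trans ∣x-y∣*D<y (m≤n*m y (suc k))))))

-- Asymptotics

module Asymptotics {n : ℕ} (op : Op n) (qg : IsQuasigroup op) (τ′ : ℕ) (U : Tuple n)
  (label : Tuple n → Fin (suc τ′)) (label-shift : IsUnitLabelling op U (suc τ′) label) (s : ℕ)
  (unit : ∀ j → UnitHasSize op U (suc τ′) label j s) (period : IsPeriod op U (suc τ′))
  (V : Tuple n) (U~V : Equiv op U V) where

  open Diagonals op qg
  open Units op qg τ′ U label label-shift s unit period
  open PointMass (_≟ᵛ_ {n} {n}) using (∑-restrict)

  ℓ : ℕ
  ℓ = proj₁ U~V

  k : ℕ
  k = ℓ % τ

  k<τ : k < τ
  k<τ = m%n<n ℓ τ

  CongMod⇒≡ℓ : ∀ {d} → CongMod τ d k → d ≡ ℓ mod τ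
  CongMod⇒≡ℓ d≡k = ≡-mod-trans (CongMod⇒≡-mod d≡k) (%≡⇒≡-mod (m%n%n≡m%n ℓ τ))

  T-vanishes-off-residue : ∀ d → ¬ CongMod τ d k → T op U V d ≡ 0
  T-vanishes-off-residue d d≢k = ¬Diagonal⇒T≡0 {d = d} λ U→V →
    d≢k (≡-mod⇒CongMod (≡-mod-trans (Diagonal-length-mod U→V (proj₂ U~V)) (≡-mod-sym (%≡⇒≡-mod (m%n%n≡m%n ℓ τ)))))

  s≥1 : 1 ≤ s
  s≥1 = subst (1 ≤_) length-home (nonempty U∈home)
    where
    nonempty : ∀ {xs : List (Tuple n)} → U ∈ xs → 1 ≤ length xs
    nonempty (here _)  = s≤s z≤n
    nonempty (there _) = s≤s z≤n

  module Mixing (m : ℕ) (0<m : 0 < m) (τ∣m : τ ∣ m)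
    (mix : ∀ {A B} → A ∈ home → B ∈ home → Diagonal op A B m) where

    instance
      m-nonZero : NonZero m
      m-nonZero = >-nonZero 0<m
      n!-nonZero : NonZero (n !)
      n!-nonZero = n !≢0

    T-mix>0 : ∀ {A B} → A ∈ home → B ∈ home → 0 < T op A B m
    T-mix>0 A∈ B∈ = Diagonal⇒T>0 (mix A∈ B∈)

    T-mix-stays : ∀ {A} B → A ∈ home → B ∉ home → T op A B m ≡ 0
    T-mix-stays B A∈ B∉ = ¬Diagonal⇒T≡0 λ A→B → B∉ (home-closed A∈ A→B (∣⇒≡0-mod τ∣m))

    ∑-home : (f : Tuple n → ℕ) → (∀ X → X ∉ home → f X ≡ 0) → ∑ (allVecs n) f ≡ ∑ home f
    ∑-home f = ∑-restrict f (allVecs⁺ n) home-unique (λ {X} _ → ∈-allVecs X)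

    ∑-home-column : ∀ d → d ≡ ℓ mod τ → ∑ home (λ B → T op B V d) ≡ (n !) ^ d
    ∑-home-column d d≡ℓ = trans (sym (∑-home _ outside)) (∑-T-column V d)
      where
      outside : ∀ X → X ∉ home → T op X V d ≡ 0
      outside X X∉ = ¬Diagonal⇒T≡0 λ X→V → X∉ (Diagonal-source-home X→V (proj₂ U~V) d≡ℓ)

    E : ℕ
    E = (n !) ^ m ∸ s

    ∑-home-row : ∀ {A} → A ∈ home → ∑ home (λ B → T op A B m ∸ 1) + s ≡ (n !) ^ m
    ∑-home-row {A} A∈ = begin
      ∑ home (λ B → T op A B m ∸ 1) + s
        ≡⟨ cong (∑ home (λ B → T op A B m ∸ 1) +_) (sym (trans (∑-const home 1) (trans (*-identityʳ _) length-home))) ⟩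
      ∑ home (λ B → T op A B m ∸ 1) + ∑ home (λ _ → 1)       ≡⟨ ∑-+ home _ _ ⟨
      ∑ home (λ B → T op A B m ∸ 1 + 1)
        ≡⟨ ∑-cong-∈ home (λ B B∈ → m∸n+n≡m (T-mix>0 A∈ B∈)) ⟩
      ∑ home (λ B → T op A B m)                              ≡⟨ ∑-home _ (λ B B∉ → T-mix-stays B A∈ B∉) ⟨
      ∑ (allVecs n) (λ B → T op A B m)                       ≡⟨ ∑-T-row A m ⟩
      (n !) ^ m                                              ∎
      where open ≡-Reasoning

    excess : ∀ {A} → A ∈ home → ∑ home (λ B → T op A B m ∸ 1) ≡ E
    excess A∈ = sym (trans (cong (_∸ s) (sym (∑-home-row A∈))) (m+n∸n≡m _ s))

    E+s≡ : E + s ≡ (n !) ^ m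
    E+s≡ = trans (cong (_+ s) (sym (excess U∈home))) (∑-home-row U∈home)

    Bounds : ℕ → ℕ → ℕ → Set
    Bounds d lo D = ∀ B → B ∈ home → lo ≤ T op B V d × T op B V d ≤ lo + D

    -- One mixing period shrinks the spread of T(·, V, d) over the unit by the factor E.
    contract : ∀ d lo D → Bounds d lo D → ∃ λ lo′ → Bounds (m + d) lo′ (E * D)
    contract d lo D bounds = S + lo * E , λ A A∈ → bounds-at A A∈
      where
      S : ℕ
      S = ∑ home (λ B → T op B V d)
      bounds-at : ∀ A → A ∈ home → S + lo * E ≤ T op A V (m + d) × T op A V (m + d) ≤ S + lo * E + E * D
      bounds-at A A∈ with ∑-weighted-bounds home (λ B → T op A B m) (λ B → T op B V d) lo D (λ B → T-mix>0 A∈) bounds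
      ... | lower , upper =
        subst₂ (λ e t → S + lo * e ≤ t) (excess A∈) (sym T≡) lower ,
        subst₂ (λ e t → t ≤ S + lo * e + e * D) (excess A∈) (sym T≡) upper
        where
        T≡ : T op A V (m + d) ≡ ∑ home (λ B → T op A B m * T op B V d)
        T≡ = trans (T-+ A V m d) (∑-home _ (λ B B∉ → cong (_* T op B V d) (T-mix-stays B A∈ B∉)))

    contract-iterate : ∀ j r → ∃ λ lo → Bounds (r + j * m) lo (E ^ j * (n !) ^ r)
    contract-iterate zero r = 0 , λ B _ → z≤n ,
      subst₂ (λ d b → T op B V d ≤ b) (sym (+-identityʳ r)) (sym (*-identityˡ _)) (T≤ B V r)
    contract-iterate (suc j) r =
      let (lo , bounds) = contract-iterate j r
          (lo′ , bounds′) = contract (r + j * m) lo (E ^ j * (n !) ^ r) bounds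
      in lo′ , λ B B∈ → subst₂ (λ d D → lo′ ≤ T op B V d × T op B V d ≤ lo′ + D)
                           (x∙yz≈y∙xz m r (j * m)) (sym (*-assoc E (E ^ j) _)) (bounds′ B B∈)

    estimate : ∀ j r → r + j * m ≡ ℓ mod τ →
      ∣ T op U V (r + j * m) * s - (n !) ^ (r + j * m) ∣ ≤ s * (E ^ j * (n !) ^ r)
    estimate j r d≡ℓ = ∣-∣≤width {L = s * lo}
      (subst (s * lo ≤_) (*-comm s _) (*-monoʳ-≤ s (proj₁ (bounds U U∈home))))
      (subst (_≤ s * lo + s * D) (*-comm s _)
        (≤-trans (*-monoʳ-≤ s (proj₂ (bounds U U∈home))) (≤-reflexive (*-distribˡ-+ s lo D))))
      (subst₂ _≤_ ∑lo (∑-home-column d d≡ℓ) (∑-mono-≤ home (λ B B∈ → proj₁ (bounds B B∈))))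
      (subst₂ _≤_ (∑-home-column d d≡ℓ) ∑hi (∑-mono-≤ home (λ B B∈ → proj₂ (bounds B B∈))))
      where
      d D lo : ℕ
      d = r + j * m
      D = E ^ j * (n !) ^ r
      lo = proj₁ (contract-iterate j r)
      bounds : Bounds d lo D
      bounds = proj₂ (contract-iterate j r)
      ∑lo : ∑ home (λ _ → lo) ≡ s * lo
      ∑lo = trans (∑-const home lo) (cong (_* lo) length-home)
      ∑hi : ∑ home (λ _ → lo + D) ≡ s * lo + s * D
      ∑hi = trans (∑-const home (lo + D)) (trans (cong (_* (lo + D)) length-home) (*-distribˡ-+ s lo D))

    error-decay : ∀ D j r → D * E + 1 ≤ j → r + j * m ≡ ℓ mod τ →
      ∣ T op U V (r + j * m) * s - (n !) ^ (r + j * m) ∣ * D < (n !) ^ (r + j * m)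
    error-decay D j r DE<j d≡ℓ = begin-strict
      ∣ T op U V (r + j * m) * s - (n !) ^ (r + j * m) ∣ * D   ≤⟨ *-monoˡ-≤ D (estimate j r d≡ℓ) ⟩
      s * (E ^ j * (n !) ^ r) * D          ≡⟨ shuffle s (E ^ j) ((n !) ^ r) D ⟩
      s * D * E ^ j * (n !) ^ r
        <⟨ *-monoˡ-< ((n !) ^ r) {{m^n≢0 (n !) r}} (geometric-gap E s D j s≥1 DE<j) ⟩
      (E + s) ^ j * (n !) ^ r              ≡⟨ cong (λ x → x ^ j * (n !) ^ r) E+s≡ ⟩
      ((n !) ^ m) ^ j * (n !) ^ r          ≡⟨ cong (_* (n !) ^ r) (^-*-assoc (n !) m j) ⟩
      (n !) ^ (m * j) * (n !) ^ r          ≡⟨ ^-distribˡ-+-* (n !) (m * j) r ⟨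
      (n !) ^ (m * j + r)
        ≡⟨ cong ((n !) ^_) (trans (+-comm (m * j) r) (cong (r +_) (*-comm m j))) ⟩
      (n !) ^ (r + j * m)                  ∎
      where
      open ≤-Reasoning
      shuffle : ∀ s e q D → s * (e * q) * D ≡ s * D * e * q
      shuffle = solve-∀

    asymptotic : AsymptoticAlong k τ (T op U V) (λ d → (n !) ^ d) s
    asymptotic ε ε>0 = j₀ * m + m , λ d j₀*m+m<d d≡k →
      relative (T op U V d * s) ((n !) ^ d)
        (subst (λ x → ∣ T op U V x * s - (n !) ^ x ∣ * D < (n !) ^ x) (sym (d≡r+jm d))
          (error-decay D (d / m) (d % m) (j₀≤d/m d j₀*m+m<d) (subst (_≡ ℓ mod τ) (d≡r+jm d) (CongMod⇒≡ℓ d≡k))))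
      where
      D j₀ : ℕ
      D = proj₁ (relative-error-ℚ ε ε>0)
      j₀ = D * E + 1
      relative : ∀ x y → ∣ x - y ∣ * D < y → ℚ.∣ ℕtoℚ x ℚ.- ℕtoℚ y ∣ ℚ.< ε ℚ.* ℕtoℚ y
      relative = proj₂ (relative-error-ℚ ε ε>0)
      d≡r+jm : ∀ d → d ≡ d % m + d / m * m
      d≡r+jm d = m≡m%n+[m/n]*n d m
      j₀≤d/m : ∀ d → j₀ * m + m < d → j₀ ≤ d / m
      j₀≤d/m d j₀*m+m<d = ≤-trans (n≤1+n j₀) (subst (_≤ d / m) (m*n/n≡m (suc j₀) m)
        (/-monoˡ-≤ m (≤-trans (≤-reflexive (+-comm m (j₀ * m))) (<⇒≤ j₀*m+m<d))))

  asymptotic : AsymptoticAlong k τ (T op U V) (λ d → (n !) ^ d) s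
  asymptotic = let m , 0<m , τ∣m , mix = mixing in Mixing.asymptotic m 0<m τ∣m mix

different-classes⇒T≡0 : ∀ {n} (op : Op n) (qg : IsQuasigroup op) {U V} → ¬ Equiv op U V → ∀ d → T op U V d ≡ 0
different-classes⇒T≡0 op qg ¬U~V d = Diagonals.¬Diagonal⇒T≡0 op qg λ U→V → ¬U~V (d , U→V)

same-class-asymptotics : ∀ {n} (op : Op n) → IsQuasigroup op → ∀ {U V} s τ →
  IsPeriod op U τ → AllUnitsHaveSize op U τ s → Equiv op U V →
  ∃ λ k → k < τ × ∃ λ d₀ →
    (∀ d → d₀ < d → ¬ CongMod τ d k → T op U V d ≡ 0) ×
    AsymptoticAlong k τ (T op U V) (λ d → (n !) ^ d) s
same-class-asymptotics op qg {U} s zero period (label , _) _ = contradiction (label U) λ ()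
same-class-asymptotics op qg {U} {V} s (suc τ′) period (label , label-shift , unit) U~V =
  k , k<τ , 0 , (λ d _ → T-vanishes-off-residue d) , asymptotic
  where open Asymptotics op qg τ′ U label label-shift s unit period V U~V

theorem8 : (n : ℕ) → 1 ≤ n → (op : Op n) → IsQuasigroup op →
    (r : Tuple n → ℕ) →
    (∀ X → 1 ≤ r X × r X ≤ n) →
    (∀ X τ → IsPeriod op X τ → AllUnitsHaveSize op X τ (r X * n ^ (n ∸ 1))) →
    (U V : Tuple n) →
    (¬ Equiv op U V → ∀ d → T op U V d ≡ 0) ×
    (Equiv op U V → ∀ τ → IsPeriod op U τ →
      ∃ λ k → k < τ × ∃ λ d₀ →
        (∀ d → d₀ < d → ¬ CongMod τ d k → T op U V d ≡ 0) ×
        AsymptoticAlong k τ (T op U V) (λ d → (n !) ^ d) (r U * n ^ (n ∸ 1)))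
theorem8 n _ op qg r _ units-have-size U V =
  different-classes⇒T≡0 op qg ,
  λ U~V τ period → same-class-asymptotics op qg (r U * n ^ (n ∸ 1)) τ period (units-have-size U τ period) U~V
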